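{- Let $F$ be a local field with residue characteristic $p$ and valuation $v_F$, let $\beta_1,\dots,\beta_k\in F^\times$, and set $r_i=-v_F(\beta_i)$. Assume $r_1\le r_2\le\dots\le r_k$, and that for every $1\le i<j\le k$ with $r_i=r_j$ the images of $\beta_i,\dots,\beta_j$ in $\mathfrak{M}_F^{ -r_i}/\mathfrak{M}_F^{ -r_i+1}$ are linearly independent over $\mathbb{F}_p$. Let $M$ be the $k\times k$ matrix whose $(i,j)$ entry is $\beta_i^{p^{j-1}}$. Then $v_F(\det M)$ equals the minimum of the valuations of the $k!$ terms in the Leibniz expansion of $\det M$; more precisely $v_F(\det M)=v_F(\beta_1\beta_2^p\cdots\beta_k^{p^{k-1}})=-(r_1+pr_2+\dots+p^{k-1}r_k).$
   Context: A local field is a field $F$ complete with respect to a discrete valuation $v_F$ with $v_F(F^\times)=\mathbb{Z}$ and perfect residue field of characteristic $p$; $\mathfrak{M}_F$ is the maximal ideal of its valuation ring. -}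

module Defs where

open import Level using (Level; suc; _⊔_)
open import Algebra.Bundles using (CommutativeRing)
open import Data.Nat as ℕ using (ℕ; zero)
open import Data.Nat.Primality using (Prime)
open import Data.Integer as ℤ using (ℤ; +_)
open import Data.Fin using (Fin; punchIn)
open import Data.Product using (Σ; ∃; _×_)
open import Relation.Binary.PropositionalEquality using (_≡_)
open import Relation.Nullary using (¬_)

-- ℤ ∪ {∞}, the codomain of a valuation (v(0) = ∞)

data ℤ∞ : Set where
  fin : ℤ → ℤ∞
  ∞   : ℤ∞

infix 4 _≤∞_
data _≤∞_ : ℤ∞ → ℤ∞ → Set where
  fin≤fin : ∀ {a b} → a ℤ.≤ b → fin a ≤∞ fin b
  _≤∞∞    : ∀ a → a ≤∞ ∞

infixl 6 _+∞_
_+∞_ : ℤ∞ → ℤ∞ → ℤ∞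
fin a +∞ fin b = fin (a ℤ.+ b)
fin a +∞ ∞     = ∞
∞     +∞ _     = ∞

min∞ : ℤ∞ → ℤ∞ → ℤ∞
min∞ (fin a) (fin b) = fin (a ℤ.⊓ b)
min∞ (fin a) ∞       = fin a
min∞ ∞       y       = y

module RingOps {c ℓ} (R : CommutativeRing c ℓ) where
  open CommutativeRing R

  _∸ᴿ_ : Carrier → Carrier → Carrier
  x ∸ᴿ y = x + (- y)

  _^ᴿ_ : Carrier → ℕ → Carrier
  x ^ᴿ zero    = 1#
  x ^ᴿ ℕ.suc n = x * (x ^ᴿ n)

  _·ᴿ_ : ℕ → Carrier → Carrier
  zero    ·ᴿ x = 0#
  ℕ.suc n ·ᴿ x = x + (n ·ᴿ x)

  sumᴿ : ∀ n → (Fin n → Carrier) → Carrier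
  sumᴿ zero    f = 0#
  sumᴿ (ℕ.suc n) f = f Fin.zero + sumᴿ n (λ i → f (Fin.suc i))

  prodᴿ : ∀ n → (Fin n → Carrier) → Carrier
  prodᴿ zero    f = 1#
  prodᴿ (ℕ.suc n) f = f Fin.zero * prodᴿ n (λ i → f (Fin.suc i))

  altSumᴿ : ∀ n → (Fin n → Carrier) → Carrier
  altSumᴿ zero    f = 0#
  altSumᴿ (ℕ.suc n) f = f Fin.zero + (- altSumᴿ n (λ i → f (Fin.suc i)))

  det : ∀ n → (Fin n → Fin n → Carrier) → Carrier
  det zero      A = 1#
  det (ℕ.suc n) A =
    altSumᴿ (ℕ.suc n) (λ i → A i Fin.zero * det n (λ a b → A (punchIn i a) (Fin.suc b)))

record LocalField (c ℓ : Level) (p : ℕ) : Set (suc (c ⊔ ℓ)) where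
  field
    commRing : CommutativeRing c ℓ
  open CommutativeRing commRing public
  open RingOps commRing public
  field
    1≉0     : ¬ (1# ≈ 0#)
    inverse : ∀ x → ¬ (x ≈ 0#) → ∃ λ y → x * y ≈ 1#
    v        : Carrier → ℤ∞
    v-cong   : ∀ {x y} → x ≈ y → v x ≡ v y
    v-∞⇒0    : ∀ x → v x ≡ ∞ → x ≈ 0#
    v-0      : v 0# ≡ ∞
    v-mul    : ∀ x y → v (x * y) ≡ v x +∞ v y
    v-add    : ∀ x y → min∞ (v x) (v y) ≤∞ v (x + y)
    v-surj   : ∀ (n : ℤ) → ∃ λ x → v x ≡ fin n
    complete : ∀ (s : ℕ → Carrier) →
      (∀ (n : ℤ) → ∃ λ N → ∀ m m' → N ℕ.≤ m → N ℕ.≤ m' → fin n ≤∞ v (s m ∸ᴿ s m')) →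
      ∃ λ L → ∀ (n : ℤ) → ∃ λ N → ∀ m → N ℕ.≤ m → fin n ≤∞ v (s m ∸ᴿ L)
    -- residue field O/𝔐 has (prime) characteristic p: p·1 ∈ 𝔐
    p-prime   : Prime p
    residue-p : fin (+ 1) ≤∞ v (p ·ᴿ 1#)
    -- residue field is perfect: every x ∈ O is a p-th power modulo 𝔐
    perfect   : ∀ x → fin (+ 0) ≤∞ v x →
      ∃ λ y → (fin (+ 0) ≤∞ v y) × (fin (+ 1) ≤∞ v ((y ^ᴿ p) ∸ᴿ x))

sumℤ : ∀ n → (Fin n → ℤ) → ℤ
sumℤ zero      f = + 0
sumℤ (ℕ.suc n) f = f Fin.zero ℤ.+ sumℤ n (λ i → f (Fin.suc i))

{-# OPTIONS --safe #-}
module Submission where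

-- Write moore e k β = det (βᵢ ^ p ^ (e + j)), so the theorem is about moore 0 k β.  Expanding
-- along the first column, every term of moore e k β has valuation at least -Σⱼ p ^ (e + j) rⱼ,
-- since for increasing r this is the largest way of distributing the exponents over the rᵢ.
-- Let β₀, …, βₙ be the leading run of equal valuations -ρ.  Expansion terms in which a later row
-- meets the first column lose at least one unit of valuation, so moore e β is congruent to
-- moore e (β₀ … βₙ) · moore (e + n + 1) (βₙ₊₁ …) modulo strictly higher valuation, and the second
-- factor is handled by induction.  Scaling the run by an element of valuation ρ turns its Moore
-- determinant into one of units whose residues are 𝔽ₚ-independent, and such a Moore determinant
-- is nonzero in any field of characteristic p: dividing by x₀ and subtracting consecutive
-- columns reduces it to the Moore determinant of the yᵢᵖ - yᵢ (yᵢ = xᵢ / x₀), which are again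
-- independent because the fixed points of Frobenius are exactly 𝔽ₚ.

open import Defs
open import Level using (Level; _⊔_)
open import Function using (_∘_)
open import Algebra.Bundles using (CommutativeRing)
open import Algebra.Structures using (IsCommutativeRing)
open import Data.Nat as ℕ using (ℕ; zero; suc; _^_; _!; s≤s; z≤n)
import Data.Nat.Properties as ℕP
open import Data.Nat.Divisibility using (_∣_; divides; ∣⇒≤; m∣m*n; ∣1⇒≡1)
open import Data.Nat.Primality using (Prime; euclidsLemma; prime⇒nonTrivial; ¬prime[0]; ¬prime[1])
open import Data.Nat.Combinatorics using (_C_; nCn≡1; nCk≡n!/k![n-k]!; k![n∸k]!∣n!)
open import Data.Nat.DivMod using (m/n*n≡m)
open import Data.Nat.GCD using (module Bézout)
import Data.Nat.Coprimality as Coprimality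
open import Data.Nat.Induction using (<-rec)
open import Data.Integer as ℤ using (ℤ; +_; -[1+_]; _⊖_)
import Data.Integer.Properties as ℤP
open import Data.Integer.Tactic.RingSolver using (solve-∀)
open import Data.Sign as Sign using (Sign)
open import Data.Fin as Fin using (Fin; zero; suc; punchIn; toℕ; fromℕ; inject₁; _↑ˡ_; _↑ʳ_)
import Data.Fin.Properties as FinP
open import Data.Fin.Permutation using (Permutation′; _⟨$⟩ʳ_; _⟨$⟩ˡ_; inverseʳ; remove; punchIn-permute′)
open import Data.Vec as Vec using (Vec; []; _∷_)
import Data.Vec.Functional as Vector
open import Data.Maybe using (Maybe; just; nothing)
open import Data.Product using (Σ; ∃; _×_; _,_; proj₁; proj₂)
open import Data.Sum using (_⊎_; inj₁; inj₂)
open import Relation.Nullary using (¬_; Dec; yes; no; contradiction)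
open import Relation.Binary.Definitions using (tri<; tri≈; tri>)
open import Relation.Binary.PropositionalEquality as ≡ using (_≡_)


-- The solver needs integer coefficients: with coefficients in the ring
-- itself it cannot see that 1# + - 1# is zero.
module ℤ-CoefficientRingSolver {c ℓ} (R : CommutativeRing c ℓ) where
  open CommutativeRing R
  open import Algebra.Properties.Semiring.Mult semiring using (×-homo-+; ×1-homo-*) renaming (_×_ to _·_)
  open import Algebra.Properties.Ring ring using (-‿distribˡ-*; -‿distribʳ-*; -‿involutive; -‿anti-homo-+; -0#≈0#)
  open import Algebra.Solver.Ring.AlmostCommutativeRing using (_-Raw-AlmostCommutative⟶_; fromCommutativeRing)
  open import Relation.Binary.Reasoning.Setoid setoid

  fromℤ : ℤ → Carrier
  fromℤ (+ n)    = n · 1#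
  fromℤ -[1+ n ] = - (suc n · 1#)

  fromℤ-⊖ : ∀ m n → fromℤ (m ⊖ n) ≈ m · 1# + - (n · 1#)
  fromℤ-⊖ zero    zero    = sym (trans (+-congˡ -0#≈0#) (+-identityʳ _))
  fromℤ-⊖ zero    (suc n) = sym (+-identityˡ _)
  fromℤ-⊖ (suc m) zero    = sym (trans (+-congˡ -0#≈0#) (+-identityʳ _))
  fromℤ-⊖ (suc m) (suc n) = begin
    fromℤ (suc m ⊖ suc n)           ≡⟨ ≡.cong fromℤ (ℤP.[1+m]⊖[1+n]≡m⊖n m n) ⟩
    fromℤ (m ⊖ n)                   ≈⟨ fromℤ-⊖ m n ⟩
    m · 1# + - (n · 1#)             ≈⟨ cancel-1# (m · 1#) (n · 1#) ⟨
    (1# + m · 1#) + - (1# + n · 1#) ∎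
    where
    cancel-1# : ∀ a b → (1# + a) + - (1# + b) ≈ a + - b
    cancel-1# a b = begin
      (1# + a) + - (1# + b)     ≈⟨ +-cong (+-comm 1# a) (-‿anti-homo-+ 1# b) ⟩
      (a + 1#) + (- b + - 1#)   ≈⟨ +-assoc a 1# _ ⟩
      a + (1# + (- b + - 1#))   ≈⟨ +-congˡ (+-congˡ (+-comm (- b) (- 1#))) ⟩
      a + (1# + (- 1# + - b))   ≈⟨ +-congˡ (+-assoc 1# (- 1#) (- b)) ⟨
      a + ((1# + - 1#) + - b)   ≈⟨ +-congˡ (+-congʳ (-‿inverseʳ 1#)) ⟩
      a + (0# + - b)            ≈⟨ +-congˡ (+-identityˡ _) ⟩
      a + - b                   ∎

  signed : Sign → Carrier → Carrier
  signed Sign.+ x = x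
  signed Sign.- x = - x

  signed-cong : ∀ s {x y} → x ≈ y → signed s x ≈ signed s y
  signed-cong Sign.+ x≈y = x≈y
  signed-cong Sign.- x≈y = -‿cong x≈y

  signed-* : ∀ s t x y → signed (s Sign.* t) (x * y) ≈ signed s x * signed t y
  signed-* Sign.+ Sign.+ x y = refl
  signed-* Sign.+ Sign.- x y = -‿distribʳ-* x y
  signed-* Sign.- Sign.+ x y = -‿distribˡ-* x y
  signed-* Sign.- Sign.- x y = begin
    x * y         ≈⟨ *-congʳ (-‿involutive x) ⟨
    - - x * y     ≈⟨ -‿distribˡ-* (- x) y ⟨
    - (- x * y)   ≈⟨ -‿distribʳ-* (- x) y ⟩
    - x * - y     ∎

  fromℤ-◃ : ∀ s n → fromℤ (s ℤ.◃ n) ≈ signed s (n · 1#)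
  fromℤ-◃ Sign.+ zero    = refl
  fromℤ-◃ Sign.- zero    = sym -0#≈0#
  fromℤ-◃ Sign.+ (suc n) = refl
  fromℤ-◃ Sign.- (suc n) = refl

  fromℤ-signAbs : ∀ i → fromℤ i ≈ signed (ℤ.sign i) (ℤ.∣ i ∣ · 1#)
  fromℤ-signAbs (+ zero)  = refl
  fromℤ-signAbs (+ suc n) = refl
  fromℤ-signAbs -[1+ n ]  = refl

  fromℤ-homo-* : ∀ i j → fromℤ (i ℤ.* j) ≈ fromℤ i * fromℤ j
  fromℤ-homo-* i j = begin
    fromℤ (i ℤ.* j)                                   ≈⟨ fromℤ-◃ s (ℤ.∣ i ∣ ℕ.* ℤ.∣ j ∣) ⟩
    signed s ((ℤ.∣ i ∣ ℕ.* ℤ.∣ j ∣) · 1#)            ≈⟨ signed-cong s (×1-homo-* ℤ.∣ i ∣ ℤ.∣ j ∣) ⟩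
    signed s ((ℤ.∣ i ∣ · 1#) * (ℤ.∣ j ∣ · 1#))       ≈⟨ signed-* (ℤ.sign i) (ℤ.sign j) _ _ ⟩
    signed (ℤ.sign i) (ℤ.∣ i ∣ · 1#) * signed (ℤ.sign j) (ℤ.∣ j ∣ · 1#) ≈⟨ *-cong (fromℤ-signAbs i) (fromℤ-signAbs j) ⟨
    fromℤ i * fromℤ j                                 ∎
    where s = ℤ.sign i Sign.* ℤ.sign j

  fromℤ-homo-+ : ∀ i j → fromℤ (i ℤ.+ j) ≈ fromℤ i + fromℤ j
  fromℤ-homo-+ (+ m)    (+ n)    = ×-homo-+ 1# m n
  fromℤ-homo-+ (+ m)    -[1+ n ] = fromℤ-⊖ m (suc n)
  fromℤ-homo-+ -[1+ m ] (+ n)    = trans (fromℤ-⊖ n (suc m)) (+-comm _ _)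
  fromℤ-homo-+ -[1+ m ] -[1+ n ] = begin
    - (suc (suc (m ℕ.+ n)) · 1#)      ≡⟨ ≡.cong (λ k → - (k · 1#)) (≡.sym (ℕP.+-suc (suc m) n)) ⟩
    - ((suc m ℕ.+ suc n) · 1#)        ≈⟨ -‿cong (×-homo-+ 1# (suc m) (suc n)) ⟩
    - (suc m · 1# + suc n · 1#)       ≈⟨ -‿anti-homo-+ _ _ ⟩
    - (suc n · 1#) + - (suc m · 1#)   ≈⟨ +-comm _ _ ⟩
    - (suc m · 1#) + - (suc n · 1#)   ∎

  fromℤ-homo-neg : ∀ i → fromℤ (ℤ.- i) ≈ - fromℤ i
  fromℤ-homo-neg (+ zero)  = sym -0#≈0#
  fromℤ-homo-neg (+ suc n) = refl
  fromℤ-homo-neg -[1+ n ]  = sym (-‿involutive _)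

  fromℤ-morphism : ℤ.+-*-rawRing -Raw-AlmostCommutative⟶ fromCommutativeRing R
  fromℤ-morphism = record
    { ⟦_⟧ = fromℤ ; +-homo = fromℤ-homo-+ ; *-homo = fromℤ-homo-* ; -‿homo = fromℤ-homo-neg
    ; 0-homo = refl ; 1-homo = +-identityʳ 1# }

  fromℤ-≟ : ∀ i j → Maybe (fromℤ i ≈ fromℤ j)
  fromℤ-≟ i j with i ℤ.≟ j
  ... | yes ≡.refl = just refl
  ... | no _       = nothing

  open import Algebra.Solver.Ring ℤ.+-*-rawRing (fromCommutativeRing R) fromℤ-morphism fromℤ-≟ public

module RingOpsProperties {c ℓ} (R : CommutativeRing c ℓ) where
  open CommutativeRing R hiding (zero)
  open RingOps R
  open ℤ-CoefficientRingSolver R public using (solve; _:+_; _:*_; :-_; _:-_; _:=_)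
  open import Relation.Binary.Reasoning.Setoid setoid
  open import Algebra.Properties.Ring ring using (-0#≈0#; -‿anti-homo-+)
  import Algebra.Properties.Semiring.Exp semiring as Exp
  import Algebra.Properties.CommutativeSemiring.Exp commutativeSemiring as CExp
  import Algebra.Properties.Semiring.Mult semiring as Mult
  import Algebra.Properties.CommutativeMonoid.Mult +-commutativeMonoid as CMult
  import Algebra.Definitions.RawMonoid +-rawMonoid as Additive
  import Algebra.Properties.CommutativeSemiring.Binomial commutativeSemiring as Binomial

  ^ᴿ≡^ : ∀ x n → x ^ᴿ n ≡ x Exp.^ n
  ^ᴿ≡^ x zero    = ≡.refl
  ^ᴿ≡^ x (suc n) = ≡.cong (x *_) (^ᴿ≡^ x n)

  ·ᴿ≡× : ∀ n x → n ·ᴿ x ≡ n Mult.× x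
  ·ᴿ≡× zero    x = ≡.refl
  ·ᴿ≡× (suc n) x = ≡.cong (λ y → x + y) (·ᴿ≡× n x)

  sumᴿ≡sum : ∀ n (f : Fin n → Carrier) → sumᴿ n f ≡ Additive.sum f
  sumᴿ≡sum zero    f = ≡.refl
  sumᴿ≡sum (suc n) f = ≡.cong (λ y → f zero + y) (sumᴿ≡sum n (f ∘ suc))

  ^ᴿ-congˡ : ∀ n {x y} → x ≈ y → x ^ᴿ n ≈ y ^ᴿ n
  ^ᴿ-congˡ zero    x≈y = refl
  ^ᴿ-congˡ (suc n) x≈y = *-cong x≈y (^ᴿ-congˡ n x≈y)

  ^ᴿ-congʳ : ∀ x {m n} → m ≡ n → x ^ᴿ m ≈ x ^ᴿ n
  ^ᴿ-congʳ x ≡.refl = refl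

  ^ᴿ-assocʳ : ∀ x m n → x ^ᴿ (m ℕ.* n) ≈ (x ^ᴿ m) ^ᴿ n
  ^ᴿ-assocʳ x m n rewrite ^ᴿ≡^ x (m ℕ.* n) | ^ᴿ≡^ x m | ^ᴿ≡^ (x Exp.^ m) n = sym (Exp.^-assocʳ x m n)

  ^ᴿ-distrib-* : ∀ x y n → (x * y) ^ᴿ n ≈ x ^ᴿ n * y ^ᴿ n
  ^ᴿ-distrib-* x y n rewrite ^ᴿ≡^ (x * y) n | ^ᴿ≡^ x n | ^ᴿ≡^ y n = CExp.^-distrib-* x y n

  1^ᴿ : ∀ n → 1# ^ᴿ n ≈ 1#
  1^ᴿ zero    = refl
  1^ᴿ (suc n) = trans (*-identityˡ _) (1^ᴿ n)

  0^ᴿ-positive : ∀ n → 0 ℕ.< n → 0# ^ᴿ n ≈ 0#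
  0^ᴿ-positive (suc n) _ = zeroˡ _

  ·ᴿ-congʳ : ∀ n {x y} → x ≈ y → n ·ᴿ x ≈ n ·ᴿ y
  ·ᴿ-congʳ zero    x≈y = refl
  ·ᴿ-congʳ (suc n) x≈y = +-cong x≈y (·ᴿ-congʳ n x≈y)

  ·ᴿ-homo-+ : ∀ x m n → (m ℕ.+ n) ·ᴿ x ≈ m ·ᴿ x + n ·ᴿ x
  ·ᴿ-homo-+ x m n rewrite ·ᴿ≡× (m ℕ.+ n) x | ·ᴿ≡× m x | ·ᴿ≡× n x = Mult.×-homo-+ x m n

  ·ᴿ-assocˡ : ∀ x m n → m ·ᴿ (n ·ᴿ x) ≈ (m ℕ.* n) ·ᴿ x
  ·ᴿ-assocˡ x m n rewrite ·ᴿ≡× n x | ·ᴿ≡× m (n Mult.× x) | ·ᴿ≡× (m ℕ.* n) x = Mult.×-assocˡ x m n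

  ·ᴿ1-homo-* : ∀ m n → (m ℕ.* n) ·ᴿ 1# ≈ (m ·ᴿ 1#) * (n ·ᴿ 1#)
  ·ᴿ1-homo-* m n rewrite ·ᴿ≡× (m ℕ.* n) 1# | ·ᴿ≡× m 1# | ·ᴿ≡× n 1# = Mult.×1-homo-* m n

  ·ᴿ-assoc-* : ∀ n x y → (n ·ᴿ x) * y ≈ n ·ᴿ (x * y)
  ·ᴿ-assoc-* n x y rewrite ·ᴿ≡× n x | ·ᴿ≡× n (x * y) = Mult.×-assoc-* n x y

  ·ᴿ-comm-* : ∀ n x y → x * (n ·ᴿ y) ≈ n ·ᴿ (x * y)
  ·ᴿ-comm-* n x y rewrite ·ᴿ≡× n y | ·ᴿ≡× n (x * y) = Mult.×-comm-* n x y

  ·ᴿ-distrib-+ : ∀ n x y → n ·ᴿ (x + y) ≈ n ·ᴿ x + n ·ᴿ y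
  ·ᴿ-distrib-+ n x y rewrite ·ᴿ≡× n (x + y) | ·ᴿ≡× n x | ·ᴿ≡× n y = CMult.×-distrib-+ x y n

  ·ᴿ-zeroʳ : ∀ n → n ·ᴿ 0# ≈ 0#
  ·ᴿ-zeroʳ zero    = refl
  ·ᴿ-zeroʳ (suc n) = trans (+-identityˡ _) (·ᴿ-zeroʳ n)

  ·ᴿ-neg : ∀ n x → n ·ᴿ (- x) ≈ - (n ·ᴿ x)
  ·ᴿ-neg zero    x = sym -0#≈0#
  ·ᴿ-neg (suc n) x = trans (+-congˡ (·ᴿ-neg n x)) (sym (trans (-‿anti-homo-+ x _) (+-comm _ _)))

  sumᴿ-cong : ∀ n {f g : Fin n → Carrier} → (∀ i → f i ≈ g i) → sumᴿ n f ≈ sumᴿ n g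
  sumᴿ-cong zero    f≈g = refl
  sumᴿ-cong (suc n) f≈g = +-cong (f≈g zero) (sumᴿ-cong n (f≈g ∘ suc))

  sumᴿ-zero : ∀ n (f : Fin n → Carrier) → (∀ i → f i ≈ 0#) → sumᴿ n f ≈ 0#
  sumᴿ-zero zero    f f≈0 = refl
  sumᴿ-zero (suc n) f f≈0 = trans (+-cong (f≈0 zero) (sumᴿ-zero n (f ∘ suc) (f≈0 ∘ suc))) (+-identityˡ 0#)

  sumᴿ-distrib-+ : ∀ n (f g : Fin n → Carrier) → sumᴿ n (λ i → f i + g i) ≈ sumᴿ n f + sumᴿ n g
  sumᴿ-distrib-+ zero    f g = sym (+-identityʳ 0#)
  sumᴿ-distrib-+ (suc n) f g = trans (+-congˡ (sumᴿ-distrib-+ n (f ∘ suc) (g ∘ suc)))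
    (solve 4 (λ a b c d → (a :+ b) :+ (c :+ d) := (a :+ c) :+ (b :+ d)) refl _ _ _ _)

  sumᴿ-neg : ∀ n (f : Fin n → Carrier) → sumᴿ n (λ i → - f i) ≈ - sumᴿ n f
  sumᴿ-neg zero    f = sym -0#≈0#
  sumᴿ-neg (suc n) f = trans (+-congˡ (sumᴿ-neg n (f ∘ suc))) (sym (trans (-‿anti-homo-+ _ _) (+-comm _ _)))

  *-distribˡ-sumᴿ : ∀ n x (f : Fin n → Carrier) → x * sumᴿ n f ≈ sumᴿ n (λ i → x * f i)
  *-distribˡ-sumᴿ zero    x f = zeroʳ x
  *-distribˡ-sumᴿ (suc n) x f = trans (distribˡ x _ _) (+-congˡ (*-distribˡ-sumᴿ n x (f ∘ suc)))

  sumᴿ-init-last : ∀ n (f : Fin (suc n) → Carrier) → sumᴿ (suc n) f ≈ sumᴿ n (f ∘ inject₁) + f (fromℕ n)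
  sumᴿ-init-last zero    f = trans (+-identityʳ _) (sym (+-identityˡ _))
  sumᴿ-init-last (suc n) f = trans (+-congˡ (sumᴿ-init-last n (f ∘ suc))) (sym (+-assoc _ _ _))

  altSumᴿ-cong : ∀ n {f g : Fin n → Carrier} → (∀ i → f i ≈ g i) → altSumᴿ n f ≈ altSumᴿ n g
  altSumᴿ-cong zero    f≈g = refl
  altSumᴿ-cong (suc n) f≈g = +-cong (f≈g zero) (-‿cong (altSumᴿ-cong n (f≈g ∘ suc)))

  altSumᴿ-zero : ∀ n (f : Fin n → Carrier) → (∀ i → f i ≈ 0#) → altSumᴿ n f ≈ 0#
  altSumᴿ-zero zero    f f≈0 = refl
  altSumᴿ-zero (suc n) f f≈0 = trans (+-cong (f≈0 zero) (-‿cong (altSumᴿ-zero n (f ∘ suc) (f≈0 ∘ suc))))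
    (trans (+-identityˡ _) -0#≈0#)

  altSumᴿ-distrib-+ : ∀ n (f g : Fin n → Carrier) → altSumᴿ n (λ i → f i + g i) ≈ altSumᴿ n f + altSumᴿ n g
  altSumᴿ-distrib-+ zero    f g = sym (+-identityʳ 0#)
  altSumᴿ-distrib-+ (suc n) f g = trans (+-congˡ (-‿cong (altSumᴿ-distrib-+ n (f ∘ suc) (g ∘ suc))))
    (solve 4 (λ a b c d → (a :+ b) :+ (:- (c :+ d)) := (a :+ (:- c)) :+ (b :+ (:- d))) refl _ _ _ _)

  altSumᴿ-neg : ∀ n (f : Fin n → Carrier) → altSumᴿ n (λ i → - f i) ≈ - altSumᴿ n f
  altSumᴿ-neg zero    f = sym -0#≈0#
  altSumᴿ-neg (suc n) f = trans (+-congˡ (-‿cong (altSumᴿ-neg n (f ∘ suc))))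
    (solve 2 (λ a b → (:- a) :+ (:- (:- b)) := :- (a :+ (:- b))) refl _ _)

  *-distribˡ-altSumᴿ : ∀ n x (f : Fin n → Carrier) → x * altSumᴿ n f ≈ altSumᴿ n (λ i → x * f i)
  *-distribˡ-altSumᴿ zero    x f = zeroʳ x
  *-distribˡ-altSumᴿ (suc n) x f = trans
    (solve 3 (λ x a b → x :* (a :+ (:- b)) := x :* a :+ (:- (x :* b))) refl x _ _)
    (+-congˡ (-‿cong (*-distribˡ-altSumᴿ n x (f ∘ suc))))

  altSumᴿ-distrib-- : ∀ n (f g : Fin n → Carrier) → altSumᴿ n (λ i → f i + - g i) ≈ altSumᴿ n f + - altSumᴿ n g
  altSumᴿ-distrib-- n f g = trans (altSumᴿ-distrib-+ n f (λ i → - g i)) (+-congˡ (altSumᴿ-neg n g))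

  freshman's-dream : ∀ n → 0 ℕ.< n → (∀ k → 0 ℕ.< k → k ℕ.< n → (n C k) ·ᴿ 1# ≈ 0#) →
    ∀ x y → (x + y) ^ᴿ n ≈ x ^ᴿ n + y ^ᴿ n
  freshman's-dream n@(suc m) _ nCk≈0 x y = begin
    (x + y) ^ᴿ n                                           ≡⟨ ^ᴿ≡^ (x + y) n ⟩
    (x + y) Exp.^ n                                        ≈⟨ Binomial.theorem n x y ⟩
    Binomial.binomialExpansion x y n                       ≡⟨ sumᴿ≡sum (suc n) t ⟨
    t zero + sumᴿ n (t ∘ suc)                              ≈⟨ +-congˡ (sumᴿ-init-last m (t ∘ suc)) ⟩
    t zero + (sumᴿ m (t ∘ suc ∘ inject₁) + t (suc (fromℕ m))) ≈⟨ +-cong t₀ (+-cong (sumᴿ-zero m _ middle≈0) tₙ) ⟩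
    y ^ᴿ n + (0# + x ^ᴿ n)                                 ≈⟨ trans (+-congˡ (+-identityˡ _)) (+-comm _ _) ⟩
    x ^ᴿ n + y ^ᴿ n                                        ∎
    where
    t = Binomial.binomialTerm x y n
    t₀ : t zero ≈ y ^ᴿ n
    t₀ = trans (Mult.×-homo-1 _) (trans (*-identityˡ _) (reflexive (≡.sym (^ᴿ≡^ y n))))
    tₙ : t (suc (fromℕ m)) ≈ x ^ᴿ n
    tₙ = begin
      t (suc (fromℕ m))
        ≡⟨ ≡.cong (λ k → (n C k) Mult.× (x Exp.^ k * y Exp.^ (n ℕ.∸ k))) (FinP.toℕ-fromℕ n) ⟩
      (n C n) Mult.× (x Exp.^ n * y Exp.^ (n ℕ.∸ n))
        ≡⟨ ≡.cong₂ (λ a b → a Mult.× (x Exp.^ n * y Exp.^ b)) (nCn≡1 n) (ℕP.n∸n≡0 n) ⟩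
      1 Mult.× (x Exp.^ n * 1#)                      ≈⟨ trans (Mult.×-homo-1 _) (*-identityʳ _) ⟩
      x Exp.^ n                                      ≡⟨ ^ᴿ≡^ x n ⟨
      x ^ᴿ n                                         ∎
    middle≈0 : ∀ i → t (suc (inject₁ i)) ≈ 0#
    middle≈0 i = begin
      (n C k) Mult.× _     ≡⟨ ·ᴿ≡× (n C k) _ ⟨
      (n C k) ·ᴿ _         ≈⟨ ·ᴿ-congʳ (n C k) (*-identityˡ _) ⟨
      (n C k) ·ᴿ (1# * _)  ≈⟨ ·ᴿ-assoc-* (n C k) 1# _ ⟨
      (n C k) ·ᴿ 1# * _    ≈⟨ *-congʳ (nCk≈0 k (s≤s z≤n) (s≤s i<m)) ⟩
      0# * _               ≈⟨ zeroˡ _ ⟩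
      0#                   ∎
      where
      k = toℕ (suc (inject₁ i))
      i<m : toℕ (inject₁ i) ℕ.< m
      i<m = ≡.subst (ℕ._< m) (≡.sym (FinP.toℕ-inject₁ i)) (FinP.toℕ<n i)

module DeterminantProperties {c ℓ} (R : CommutativeRing c ℓ) where
  open CommutativeRing R hiding (zero)
  open RingOps R
  open RingOpsProperties R
  open import Relation.Binary.Reasoning.Setoid setoid
  open import Algebra.Properties.Ring ring using (-0#≈0#)

  Matrix : ℕ → Set c
  Matrix n = Fin n → Fin n → Carrier

  det-cong : ∀ n {A B : Matrix n} → (∀ i j → A i j ≈ B i j) → det n A ≈ det n B
  det-cong zero    A≈B = refl
  det-cong (suc n) A≈B = altSumᴿ-cong (suc n) λ i →
    *-cong (A≈B i zero) (det-cong n (λ a b → A≈B (punchIn i a) (suc b)))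

  det-scaleColumns : ∀ n (A : Matrix n) (d : Fin n → Carrier) → det n (λ i j → A i j * d j) ≈ prodᴿ n d * det n A
  det-scaleColumns zero    A d = sym (*-identityˡ 1#)
  det-scaleColumns (suc n) A d = begin
    altSumᴿ (suc n) (λ i → A i zero * d zero * det n (λ a b → A (punchIn i a) (suc b) * d (suc b)))
      ≈⟨ altSumᴿ-cong (suc n) (λ i → *-congˡ {A i zero * d zero} (det-scaleColumns n (λ a b → A (punchIn i a) (suc b)) (d ∘ suc))) ⟩
    altSumᴿ (suc n) (λ i → A i zero * d zero * (prodᴿ n (d ∘ suc) * minor i))
      ≈⟨ altSumᴿ-cong (suc n) (λ i → solve 4 (λ a x y z → a :* x :* (y :* z) := (x :* y) :* (a :* z)) refl
                                              (A i zero) (d zero) (prodᴿ n (d ∘ suc)) (minor i)) ⟩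
    altSumᴿ (suc n) (λ i → prodᴿ (suc n) d * (A i zero * minor i))
      ≈⟨ *-distribˡ-altSumᴿ (suc n) (prodᴿ (suc n) d) (λ i → A i zero * minor i) ⟨
    prodᴿ (suc n) d * det (suc n) A ∎
    where
    minor : Fin (suc n) → Carrier
    minor i = det n (λ a b → A (punchIn i a) (suc b))

  det-zeroRow₀ : ∀ n (A : Matrix (suc n)) → (∀ j → A zero j ≈ 0#) → det (suc n) A ≈ 0#
  expansion-zeroRow₀ : ∀ n (A : Matrix (suc n)) → (∀ j → A zero (suc j) ≈ 0#) →
    altSumᴿ n (λ i → A (suc i) zero * det n (λ a b → A (punchIn (suc i) a) (suc b))) ≈ 0#

  det-zeroRow₀ n A A₀≈0 = begin
    A zero zero * _ + - altSumᴿ n _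
      ≈⟨ +-cong (trans (*-congʳ (A₀≈0 zero)) (zeroˡ _)) (-‿cong (expansion-zeroRow₀ n A (A₀≈0 ∘ suc))) ⟩
    0# + - 0#                       ≈⟨ trans (+-identityˡ _) -0#≈0# ⟩
    0#                              ∎

  expansion-zeroRow₀ zero    A A₀≈0 = refl
  expansion-zeroRow₀ (suc n) A A₀≈0 = altSumᴿ-zero (suc n) _ λ i →
    trans (*-congˡ {A (suc i) zero} (det-zeroRow₀ n (λ a b → A (punchIn (suc i) a) (suc b)) A₀≈0)) (zeroʳ _)

  det-firstRow : ∀ n (A : Matrix (suc n)) → (∀ j → A zero (suc j) ≈ 0#) →
    det (suc n) A ≈ A zero zero * det n (λ a b → A (suc a) (suc b))
  det-firstRow n A A₀≈0 = trans (+-congˡ (trans (-‿cong (expansion-zeroRow₀ n A A₀≈0)) -0#≈0#)) (+-identityʳ _)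

  -- det (2 + m) A unfolds definitionally to det₂ m (column 0) (column 1) (the other columns).
  det₂ : ∀ m (a b : Fin (2 ℕ.+ m) → Carrier) → (Fin (2 ℕ.+ m) → Fin m → Carrier) → Carrier
  det₂ m a b M = altSumᴿ (2 ℕ.+ m) λ i → a i * altSumᴿ (1 ℕ.+ m) λ j →
    b (punchIn i j) * det m (λ x y → M (punchIn i (punchIn j x)) y)

  det₂-sub : ∀ m a b b′ M → det₂ m a (λ i → b i + - b′ i) M ≈ det₂ m a b M + - det₂ m a b′ M
  det₂-sub m a b b′ M = trans (altSumᴿ-cong (2 ℕ.+ m) rowᵢ) (altSumᴿ-distrib-- (2 ℕ.+ m) (row b) (row b′))
    where
    D : Fin (2 ℕ.+ m) → Fin (1 ℕ.+ m) → Carrier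
    D i j = det m (λ x y → M (punchIn i (punchIn j x)) y)
    _·D_ : (Fin (2 ℕ.+ m) → Carrier) → Fin (2 ℕ.+ m) → Fin (1 ℕ.+ m) → Carrier
    (c ·D i) j = c (punchIn i j) * D i j
    row : (Fin (2 ℕ.+ m) → Carrier) → Fin (2 ℕ.+ m) → Carrier
    row c i = a i * altSumᴿ (1 ℕ.+ m) (c ·D i)
    rowᵢ : ∀ i → row (λ i → b i + - b′ i) i ≈ row b i + - row b′ i
    rowᵢ i = begin
      a i * altSumᴿ (1 ℕ.+ m) (λ j → (b (punchIn i j) + - b′ (punchIn i j)) * D i j)
        ≈⟨ *-congˡ (altSumᴿ-cong (1 ℕ.+ m) λ j →
             solve 3 (λ x y d → (x :- y) :* d := x :* d :- y :* d) refl (b (punchIn i j)) (b′ (punchIn i j)) (D i j)) ⟩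
      a i * altSumᴿ (1 ℕ.+ m) (λ j → (b ·D i) j + - (b′ ·D i) j)
        ≈⟨ *-congˡ (altSumᴿ-distrib-- (1 ℕ.+ m) (b ·D i) (b′ ·D i)) ⟩
      a i * (altSumᴿ (1 ℕ.+ m) (b ·D i) + - altSumᴿ (1 ℕ.+ m) (b′ ·D i))
        ≈⟨ solve 3 (λ x y z → x :* (y :- z) := x :* y :- x :* z) refl (a i) _ _ ⟩
      row b i + - row b′ i ∎

  Extensional : ∀ {m n} → ((Fin m → Fin n) → Carrier) → Set ℓ
  Extensional Φ = ∀ f g → (∀ x → f x ≡ g x) → Φ f ≈ Φ g

  pairSum : ∀ m → (Fin (2 ℕ.+ m) → Carrier) → ((Fin m → Fin (2 ℕ.+ m)) → Carrier) → Carrier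
  pairSum m α Φ = altSumᴿ (2 ℕ.+ m) λ i → altSumᴿ (1 ℕ.+ m) λ j → α i * (α (punchIn i j) * Φ (punchIn i ∘ punchIn j))

  -- The terms with i = 0 cancel against those with j = 0.
  pairSum≈pairSum-tail : ∀ m α Φ → pairSum m α Φ ≈
    altSumᴿ (1 ℕ.+ m) λ i → altSumᴿ m λ j → α (suc i) * (α (suc (punchIn i j)) * Φ (punchIn (suc i) ∘ punchIn (suc j)))
  pairSum≈pairSum-tail m α Φ = begin
    pairSum m α Φ
      ≈⟨ +-cong (altSumᴿ-cong (1 ℕ.+ m) λ j → solve 3 (λ a b z → a :* (b :* z) := b :* (a :* z)) refl
                                                  (α zero) (α (suc j)) (Φ (punchIn zero ∘ punchIn j)))
                (-‿cong (altSumᴿ-distrib-- (1 ℕ.+ m) S₀-term T-term)) ⟩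
    S₀ + - (S₀ + - T) ≈⟨ solve 2 (λ s t → s :+ (:- (s :+ (:- t))) := t) refl S₀ T ⟩
    T ∎
    where
    S₀-term T-term : Fin (1 ℕ.+ m) → Carrier
    S₀-term i = α (suc i) * (α zero * Φ (punchIn (suc i) ∘ punchIn zero))
    T-term  i = altSumᴿ m λ j → α (suc i) * (α (suc (punchIn i j)) * Φ (punchIn (suc i) ∘ punchIn (suc j)))
    S₀ = altSumᴿ (1 ℕ.+ m) S₀-term
    T  = altSumᴿ (1 ℕ.+ m) T-term

  pairSum≈0 : ∀ m α Φ → Extensional Φ → pairSum m α Φ ≈ 0#
  pairSum≈0 zero    α Φ Φ-ext = trans (pairSum≈pairSum-tail zero α Φ) (trans (+-congˡ -0#≈0#) (+-identityʳ 0#))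
  pairSum≈0 (suc m) α Φ Φ-ext = begin
    pairSum (suc m) α Φ  ≈⟨ pairSum≈pairSum-tail (suc m) α Φ ⟩
    _                    ≈⟨ altSumᴿ-cong (2 ℕ.+ m) (λ i → altSumᴿ-cong (1 ℕ.+ m) λ j →
                              *-congˡ {α (suc i)} (*-congˡ {α (suc (punchIn i j))} (Φ-ext _ _ (punchIn-suc-lift i j)))) ⟩
    pairSum m (α ∘ suc) (Φ ∘ Fin.lift 1) ≈⟨ pairSum≈0 m (α ∘ suc) (Φ ∘ Fin.lift 1) (λ f g f≗g → Φ-ext _ _ (lift-cong f≗g)) ⟩
    0#                   ∎
    where
    punchIn-suc-lift : ∀ i j x → punchIn (suc i) (punchIn (suc j) x) ≡ Fin.lift 1 (punchIn i ∘ punchIn j) x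
    punchIn-suc-lift i j zero    = ≡.refl
    punchIn-suc-lift i j (suc x) = ≡.refl
    lift-cong : ∀ {f g : Fin m → Fin (2 ℕ.+ m)} → (∀ x → f x ≡ g x) → ∀ x → Fin.lift 1 f x ≡ Fin.lift 1 g x
    lift-cong f≗g zero    = ≡.refl
    lift-cong f≗g (suc x) = ≡.cong suc (f≗g x)

  det₂-diagonal : ∀ m a M → det₂ m a a M ≈ 0#
  det₂-diagonal m a M = begin
    det₂ m a a M ≈⟨ altSumᴿ-cong (2 ℕ.+ m) (λ i → *-distribˡ-altSumᴿ (1 ℕ.+ m) (a i) λ j →
                       a (punchIn i j) * Φ (punchIn i ∘ punchIn j)) ⟩
    pairSum m a Φ ≈⟨ pairSum≈0 m a Φ (λ f g f≗g → det-cong m λ x y → reflexive (≡.cong (λ z → M z y) (f≗g x))) ⟩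
    0# ∎
    where
    Φ : (Fin m → Fin (2 ℕ.+ m)) → Carrier
    Φ f = det m (λ x y → M (f x) y)

  differences : ∀ {n} → (Fin (suc n) → Carrier) → Fin (suc n) → Carrier
  differences v zero    = v zero
  differences v (suc b) = v (suc b) + - v (inject₁ b)

  det-differences : ∀ n (A : Matrix (suc n)) → det (suc n) (λ i → differences (A i)) ≈ det (suc n) A
  det-differences zero    A = refl
  det-differences (suc n) A = begin
    det (2 ℕ.+ n) (λ i → differences (A i))
      ≈⟨ det₂-sub n (λ i → A i zero) (λ i → B i (suc zero)) (λ i → A i zero) (λ i y → B i (suc (suc y))) ⟩
    det (2 ℕ.+ n) B + - det₂ n (λ i → A i zero) (λ i → A i zero) (λ i y → B i (suc (suc y)))
      ≈⟨ +-congˡ (-‿cong (det₂-diagonal n (λ i → A i zero) (λ i y → B i (suc (suc y))))) ⟩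
    det (2 ℕ.+ n) B + - 0#
      ≈⟨ trans (+-congˡ -0#≈0#) (+-identityʳ _) ⟩
    det (2 ℕ.+ n) B
      ≈⟨ altSumᴿ-cong (2 ℕ.+ n) (λ i → *-congˡ {A i zero} (det-differences n (λ a b → A (punchIn i a) (suc b)))) ⟩
    det (2 ℕ.+ n) A ∎
    where
    B : Matrix (2 ℕ.+ n)
    B a zero    = A a zero
    B a (suc b) = differences (λ y → A a (suc y)) b

p∤m! : ∀ {p} → Prime p → ∀ m → m ℕ.< p → ¬ p ∣ m !
p∤m! p-prime zero    m<p p∣1 = ℕP.<-irrefl ≡.refl (ℕP.<-≤-trans (ℕ.nonTrivial⇒n>1 _ {{prime⇒nonTrivial p-prime}}) (∣⇒≤ p∣1))
p∤m! p-prime (suc m) m<p p∣m! with euclidsLemma (suc m) (m !) p-prime p∣m!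
... | inj₁ p∣1+m = ℕP.<-irrefl ≡.refl (ℕP.<-≤-trans m<p (∣⇒≤ p∣1+m))
... | inj₂ p∣m!  = p∤m! p-prime m (ℕP.<-trans (ℕP.n<1+n m) m<p) p∣m!

p∣pCk : ∀ {p} → Prime p → ∀ k → 0 ℕ.< k → k ℕ.< p → p ∣ p C k
p∣pCk {p} p-prime k 0<k k<p with euclidsLemma (p C k) (k ! ℕ.* (p ℕ.∸ k) !) p-prime p∣pCk·k!·[p-k]!
  where
  instance _ = ℕP._!*_!≢0 k (p ℕ.∸ k)
  p∣pCk·k!·[p-k]! : p ∣ (p C k) ℕ.* (k ! ℕ.* (p ℕ.∸ k) !)
  p∣pCk·k!·[p-k]! = ≡.subst (p ∣_)
    (≡.sym (≡.trans (≡.cong (ℕ._* (k ! ℕ.* (p ℕ.∸ k) !)) (nCk≡n!/k![n-k]! (ℕP.<⇒≤ k<p)))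
                    (m/n*n≡m (k![n∸k]!∣n! (ℕP.<⇒≤ k<p)))))
    (p∣p! p (ℕP.<-trans 0<k k<p))
    where
    p∣p! : ∀ n → 0 ℕ.< n → n ∣ n !
    p∣p! (suc n) _ = m∣m*n (n !)
... | inj₁ p∣pCk = p∣pCk
... | inj₂ p∣k!·[p-k]! with euclidsLemma (k !) ((p ℕ.∸ k) !) p-prime p∣k!·[p-k]!
...   | inj₁ p∣k!     = contradiction p∣k! (p∤m! p-prime k k<p)
...   | inj₂ p∣[p-k]! = contradiction p∣[p-k]! (p∤m! p-prime (p ℕ.∸ k) (ℕP.∸-monoʳ-< {p} {k} {0} 0<k (ℕP.<⇒≤ k<p)))

_^[_+_] : ℕ → ℕ → ∀ {k} → Fin k → ℕ
p ^[ e + zero  ] = p ^ e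
p ^[ e + suc j ] = p ^[ suc e + j ]

^[+]≡^ : ∀ p e {k} (j : Fin k) → p ^[ e + j ] ≡ p ^ (e ℕ.+ toℕ j)
^[+]≡^ p e zero    = ≡.cong (p ^_) (≡.sym (ℕP.+-identityʳ e))
^[+]≡^ p e (suc j) = ≡.trans (^[+]≡^ p (suc e) j) (≡.cong (p ^_) (≡.sym (ℕP.+-suc e (toℕ j))))

^[suc+]≡*^[+] : ∀ p e {k} (j : Fin k) → p ^[ suc e + j ] ≡ p ℕ.* p ^[ e + j ]
^[suc+]≡*^[+] p e zero    = ≡.refl
^[suc+]≡*^[+] p e (suc j) = ^[suc+]≡*^[+] p (suc e) j

^[+inject₁]≡^[+] : ∀ p e {k} (j : Fin k) → p ^[ e + inject₁ j ] ≡ p ^[ e + j ]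
^[+inject₁]≡^[+] p e zero    = ≡.refl
^[+inject₁]≡^[+] p e (suc j) = ^[+inject₁]≡^[+] p (suc e) j

module MooreDeterminant {c ℓ} (R : CommutativeRing c ℓ) (p : ℕ) where
  open CommutativeRing R hiding (zero)
  open RingOps R
  open RingOpsProperties R
  open DeterminantProperties R

  moore : ℕ → ∀ k → (Fin k → Carrier) → Carrier
  moore e k x = det k (λ i j → x i ^ᴿ (p ^[ e + j ]))

  moore-cong : ∀ e k {x y : Fin k → Carrier} → (∀ i → x i ≈ y i) → moore e k x ≈ moore e k y
  moore-cong e k x≈y = det-cong k (λ i j → ^ᴿ-congˡ (p ^[ e + j ]) (x≈y i))

  moore-scale : ∀ e k (x : Fin k → Carrier) t →
    moore e k (λ i → x i * t) ≈ prodᴿ k (λ j → t ^ᴿ (p ^[ e + j ])) * moore e k x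
  moore-scale e k x t = trans (det-cong k (λ i j → ^ᴿ-distrib-* (x i) t (p ^[ e + j ])))
                              (det-scaleColumns k (λ i j → x i ^ᴿ (p ^[ e + j ])) (λ j → t ^ᴿ (p ^[ e + j ])))

module _ {c ℓ} (R : CommutativeRing c ℓ) where
  open CommutativeRing R hiding (zero)
  open RingOps R
  open RingOpsProperties R
  open import Relation.Binary.Reasoning.Setoid setoid
  open import Algebra.Properties.Ring ring using (-0#≈0#; +-inverseˡ-unique; x∙y⁻¹≈ε⇒x≈y; x≈y⇒x∙y⁻¹≈ε)

  record AdditivePower (q : ℕ) : Set (c ⊔ ℓ) where
    field
      positive : 0 ℕ.< q
      homo-+   : ∀ x y → (x + y) ^ᴿ q ≈ x ^ᴿ q + y ^ᴿ q

    homo-0 : 0# ^ᴿ q ≈ 0#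
    homo-0 = 0^ᴿ-positive q positive

    homo-neg : ∀ x → (- x) ^ᴿ q ≈ - (x ^ᴿ q)
    homo-neg x = +-inverseˡ-unique _ _ (trans (sym (homo-+ (- x) x)) (trans (^ᴿ-congˡ q (-‿inverseˡ x)) homo-0))

    homo-sub : ∀ x y → (x + - y) ^ᴿ q ≈ x ^ᴿ q + - (y ^ᴿ q)
    homo-sub x y = trans (homo-+ x (- y)) (+-congˡ (homo-neg y))

    homo-· : ∀ n x → (n ·ᴿ x) ^ᴿ q ≈ n ·ᴿ (x ^ᴿ q)
    homo-· zero    x = homo-0
    homo-· (suc n) x = trans (homo-+ x (n ·ᴿ x)) (+-congˡ (homo-· n x))

    homo-sum : ∀ n (f : Fin n → Carrier) → sumᴿ n f ^ᴿ q ≈ sumᴿ n (λ i → f i ^ᴿ q)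
    homo-sum zero    f = homo-0
    homo-sum (suc n) f = trans (homo-+ _ _) (+-congˡ (homo-sum n (f ∘ suc)))

  module CharacteristicP {p} (p-prime : Prime p) (char-p : p ·ᴿ 1# ≈ 0#) where

    p·ᴿx≈0 : ∀ x → p ·ᴿ x ≈ 0#
    p·ᴿx≈0 x = begin
      p ·ᴿ x         ≈⟨ ·ᴿ-congʳ p (*-identityˡ x) ⟨
      p ·ᴿ (1# * x)  ≈⟨ ·ᴿ-assoc-* p 1# x ⟨
      p ·ᴿ 1# * x    ≈⟨ *-congʳ char-p ⟩
      0# * x         ≈⟨ zeroˡ x ⟩
      0#             ∎

    p∣n⇒n·ᴿx≈0 : ∀ {n} x → p ∣ n → n ·ᴿ x ≈ 0#
    p∣n⇒n·ᴿx≈0 x (divides q ≡.refl) = trans (sym (·ᴿ-assocˡ x q p)) (trans (·ᴿ-congʳ q (p·ᴿx≈0 x)) (·ᴿ-zeroʳ q))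

    0<p : 0 ℕ.< p
    0<p = ℕP.<-trans (s≤s z≤n) (ℕ.nonTrivial⇒n>1 p {{prime⇒nonTrivial p-prime}})

    frobenius : AdditivePower p
    frobenius = record
      { positive = 0<p
      ; homo-+   = freshman's-dream p 0<p (λ k 0<k k<p → p∣n⇒n·ᴿx≈0 1# (p∣pCk p-prime k 0<k k<p)) }

    frobenius^ : ∀ t → AdditivePower (p ^ t)
    frobenius^ zero    = record
      { positive = s≤s z≤n
      ; homo-+   = λ x y → trans (*-identityʳ _) (sym (+-cong (*-identityʳ x) (*-identityʳ y))) }
    frobenius^ (suc t) = record
      { positive = ℕP.*-mono-< {0} {p} {0} {p ^ t} 0<p (AdditivePower.positive (frobenius^ t))
      ; homo-+   = λ x y → begin
          (x + y) ^ᴿ (p ℕ.* p ^ t)                   ≈⟨ ^ᴿ-assocʳ (x + y) p (p ^ t) ⟩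
          ((x + y) ^ᴿ p) ^ᴿ (p ^ t)                  ≈⟨ ^ᴿ-congˡ (p ^ t) (AdditivePower.homo-+ frobenius x y) ⟩
          (x ^ᴿ p + y ^ᴿ p) ^ᴿ (p ^ t)               ≈⟨ AdditivePower.homo-+ (frobenius^ t) _ _ ⟩
          (x ^ᴿ p) ^ᴿ (p ^ t) + (y ^ᴿ p) ^ᴿ (p ^ t)  ≈⟨ +-cong (^ᴿ-assocʳ x p (p ^ t)) (^ᴿ-assocʳ y p (p ^ t)) ⟨
          x ^ᴿ (p ℕ.* p ^ t) + y ^ᴿ (p ℕ.* p ^ t)    ∎ }

    frobenius^[+] : ∀ e {k} (j : Fin k) → AdditivePower (p ^[ e + j ])
    frobenius^[+] e j = ≡.subst AdditivePower (≡.sym (^[+]≡^ p e j)) (frobenius^ (e ℕ.+ toℕ j))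

    fermat : ∀ n → (n ·ᴿ 1#) ^ᴿ p ≈ n ·ᴿ 1#
    fermat n = trans (AdditivePower.homo-· frobenius n 1#) (·ᴿ-congʳ n (1^ᴿ p))

  -- Coefficient vectors list the leading coefficient first.
  eval : ∀ {n} → Vec Carrier n → Carrier → Carrier
  eval []                 x = 0#
  eval {suc n} (a ∷ as) x = a * x ^ᴿ n + eval as x

  -- Synthetic division by X - z.
  divide : ∀ {n} → Carrier → Vec Carrier (suc n) → Vec Carrier n × Carrier
  divide z (a ∷ [])     = [] , a
  divide z (a ∷ b ∷ as) = let (q , r) = divide z ((b + a * z) ∷ as) in (a ∷ q) , r

  eval-divide : ∀ {n} z (f : Vec Carrier (suc n)) x →
    eval f x ≈ (x + - z) * eval (proj₁ (divide z f)) x + proj₂ (divide z f)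
  eval-divide z (a ∷ []) x = trans (+-identityʳ _) (trans (*-identityʳ a) (sym (trans (+-congʳ (zeroʳ _)) (+-identityˡ a))))
  eval-divide {suc n} z (a ∷ b ∷ as) x = begin
    a * x ^ᴿ suc n + (b * x ^ᴿ n + eval as x)
      ≈⟨ solve 6 (λ a b x z X E → a :* (x :* X) :+ (b :* X :+ E) := (x :- z) :* (a :* X) :+ ((b :+ a :* z) :* X :+ E))
                 refl a b x z (x ^ᴿ n) (eval as x) ⟩
    (x + - z) * (a * x ^ᴿ n) + eval ((b + a * z) ∷ as) x
      ≈⟨ +-congˡ (eval-divide z ((b + a * z) ∷ as) x) ⟩
    (x + - z) * (a * x ^ᴿ n) + ((x + - z) * q + r)
      ≈⟨ solve 4 (λ u A q r → u :* A :+ (u :* q :+ r) := u :* (A :+ q) :+ r) refl (x + - z) (a * x ^ᴿ n) q r ⟩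
    (x + - z) * (a * x ^ᴿ n + q) + r ∎
    where
    q = eval (proj₁ (divide z ((b + a * z) ∷ as))) x
    r = proj₂ (divide z ((b + a * z) ∷ as))

  leadingCoefficient≈0 : (∀ {x y} → x * y ≈ 0# → ¬ x ≈ 0# → y ≈ 0#) →
    ∀ n (f : Vec Carrier (suc n)) (ζ : Fin (suc n) → Carrier) → (∀ i j → ζ i + - ζ j ≈ 0# → i ≡ j) →
    (∀ i → eval f (ζ i) ≈ 0#) → Vec.head f ≈ 0#
  leadingCoefficient≈0 _ zero (a ∷ []) ζ ζ-injective roots = trans (sym (trans (+-identityʳ _) (*-identityʳ a))) (roots zero)
  leadingCoefficient≈0 cancel (suc n) f@(a ∷ b ∷ as) ζ ζ-injective roots =
    leadingCoefficient≈0 cancel n (proj₁ (divide z f)) (ζ ∘ suc)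
      (λ i j e → FinP.suc-injective (ζ-injective (suc i) (suc j) e)) quotient-roots
    where
    z = ζ zero
    remainder≈0 : proj₂ (divide z f) ≈ 0#
    remainder≈0 = begin
      proj₂ (divide z f)                                       ≈⟨ +-identityˡ _ ⟨
      0# + proj₂ (divide z f)                                  ≈⟨ +-congʳ (trans (*-congʳ (-‿inverseʳ z)) (zeroˡ _)) ⟨
      (z + - z) * eval (proj₁ (divide z f)) z + proj₂ (divide z f) ≈⟨ eval-divide z f z ⟨
      eval f z                                                 ≈⟨ roots zero ⟩
      0#                                                       ∎
    quotient-roots : ∀ i → eval (proj₁ (divide z f)) (ζ (suc i)) ≈ 0#
    quotient-roots i = cancel (begin
      (ζ (suc i) + - z) * eval (proj₁ (divide z f)) (ζ (suc i))          ≈⟨ +-identityʳ _ ⟨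
      (ζ (suc i) + - z) * eval (proj₁ (divide z f)) (ζ (suc i)) + 0#     ≈⟨ +-congˡ remainder≈0 ⟨
      (ζ (suc i) + - z) * eval (proj₁ (divide z f)) (ζ (suc i)) + proj₂ (divide z f) ≈⟨ eval-divide z f (ζ (suc i)) ⟨
      eval f (ζ (suc i))                                                  ≈⟨ roots (suc i) ⟩
      0#                                                                  ∎)
      (λ e → contradiction (ζ-injective (suc i) zero e) λ ())

  monomial : ∀ n → ℕ → Vec Carrier n
  monomial zero    k = []
  monomial (suc n) k with n ℕ.≟ k
  ... | yes _ = 1# ∷ monomial n k
  ... | no  _ = 0# ∷ monomial n k

  eval-monomial-≥ : ∀ n k x → n ℕ.≤ k → eval (monomial n k) x ≈ 0#
  eval-monomial-≥ zero    k x _ = refl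
  eval-monomial-≥ (suc n) k x 1+n≤k with n ℕ.≟ k
  ... | yes ≡.refl = contradiction 1+n≤k (ℕP.<-irrefl ≡.refl)
  ... | no  _      = trans (+-cong (zeroˡ _) (eval-monomial-≥ n k x (ℕP.<⇒≤ 1+n≤k))) (+-identityˡ 0#)

  eval-monomial : ∀ n k x → k ℕ.< n → eval (monomial n k) x ≈ x ^ᴿ k
  eval-monomial (suc n) k x k<1+n with n ℕ.≟ k
  ... | yes ≡.refl = trans (+-cong (*-identityˡ _) (eval-monomial-≥ n n x ℕP.≤-refl)) (+-identityʳ _)
  ... | no  n≢k with ℕP.m<1+n⇒m<n∨m≡n k<1+n
  ...   | inj₁ k<n    = trans (+-cong (zeroˡ _) (eval-monomial n k x k<n)) (+-identityˡ _)
  ...   | inj₂ ≡.refl = contradiction ≡.refl n≢k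

  module FieldOfCharacteristicP {p} (p-prime : Prime p) (char-p : p ·ᴿ 1# ≈ 0#) (1≉0 : ¬ 1# ≈ 0#)
    (≈0? : ∀ x → Dec (x ≈ 0#)) (inverse : ∀ x → ¬ x ≈ 0# → ∃ λ y → x * y ≈ 1#) where
    open CharacteristicP p-prime char-p
    open MooreDeterminant R p
    open DeterminantProperties R
    open import Algebra.Properties.Ring ring using (+-cancelˡ)

    cancel : ∀ {x y} → x * y ≈ 0# → ¬ x ≈ 0# → y ≈ 0#
    cancel {x} {y} xy≈0 x≉0 = begin
      y              ≈⟨ *-identityˡ y ⟨
      1# * y         ≈⟨ *-congʳ x·x⁻¹≈1 ⟨
      x * x⁻¹ * y    ≈⟨ solve 3 (λ x x⁻¹ y → x :* x⁻¹ :* y := x⁻¹ :* (x :* y)) refl x x⁻¹ y ⟩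
      x⁻¹ * (x * y)  ≈⟨ *-congˡ xy≈0 ⟩
      x⁻¹ * 0#       ≈⟨ zeroʳ x⁻¹ ⟩
      0#             ∎
      where
      x⁻¹ = proj₁ (inverse x x≉0)
      x·x⁻¹≈1 = proj₂ (inverse x x≉0)

    *-≉0 : ∀ {x y} → ¬ x ≈ 0# → ¬ y ≈ 0# → ¬ x * y ≈ 0#
    *-≉0 x≉0 y≉0 xy≈0 = y≉0 (cancel xy≈0 x≉0)

    ^ᴿ-≉0 : ∀ {x} n → ¬ x ≈ 0# → ¬ x ^ᴿ n ≈ 0#
    ^ᴿ-≉0 zero    x≉0 = 1≉0
    ^ᴿ-≉0 (suc n) x≉0 = *-≉0 x≉0 (^ᴿ-≉0 n x≉0)

    prodᴿ-≉0 : ∀ n (f : Fin n → Carrier) → (∀ i → ¬ f i ≈ 0#) → ¬ prodᴿ n f ≈ 0#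
    prodᴿ-≉0 zero    f f≉0 = 1≉0
    prodᴿ-≉0 (suc n) f f≉0 = *-≉0 (f≉0 zero) (prodᴿ-≉0 n (f ∘ suc) (f≉0 ∘ suc))

    -- Bézout: a n = 1 + b p or 1 + a n = b p, and p · 1 = 0.
    n·1≉0 : ∀ {n} → 0 ℕ.< n → n ℕ.< p → ¬ n ·ᴿ 1# ≈ 0#
    n·1≉0 {n} 0<n n<p n·1≈0
      with Coprimality.coprime-Bézout (Coprimality.sym (Coprimality.prime⇒coprime p-prime {{ℕ.>-nonZero 0<n}} n<p))
    ... | Bézout.+- a b 1+bp≡an = 1≉0 (begin
      1#                   ≈⟨ +-identityʳ 1# ⟨
      1# + 0#              ≈⟨ +-congˡ (multiple≈0 b p char-p) ⟨
      suc (b ℕ.* p) ·ᴿ 1#  ≡⟨ ≡.cong (_·ᴿ 1#) 1+bp≡an ⟩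
      (a ℕ.* n) ·ᴿ 1#      ≈⟨ multiple≈0 a n n·1≈0 ⟩
      0#                   ∎)
      where
      multiple≈0 : ∀ a m → m ·ᴿ 1# ≈ 0# → (a ℕ.* m) ·ᴿ 1# ≈ 0#
      multiple≈0 a m m·1≈0 = trans (·ᴿ1-homo-* a m) (trans (*-congˡ m·1≈0) (zeroʳ _))
    ... | Bézout.-+ a b 1+an≡bp = 1≉0 (begin
      1#                   ≈⟨ +-identityʳ 1# ⟨
      1# + 0#              ≈⟨ +-congˡ (multiple≈0 a n n·1≈0) ⟨
      suc (a ℕ.* n) ·ᴿ 1#  ≡⟨ ≡.cong (_·ᴿ 1#) 1+an≡bp ⟩
      (b ℕ.* p) ·ᴿ 1#      ≈⟨ multiple≈0 b p char-p ⟩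
      0#                   ∎)
      where
      multiple≈0 : ∀ a m → m ·ᴿ 1# ≈ 0# → (a ℕ.* m) ·ᴿ 1# ≈ 0#
      multiple≈0 a m m·1≈0 = trans (·ᴿ1-homo-* a m) (trans (*-congˡ m·1≈0) (zeroʳ _))

    ·1-distinct : ∀ {m n} → m ℕ.< n → n ℕ.< p → ¬ m ·ᴿ 1# ≈ n ·ᴿ 1#
    ·1-distinct {m} {n} m<n n<p m·1≈n·1 =
      n·1≉0 (ℕP.m<n⇒0<n∸m m<n) (ℕP.≤-<-trans (ℕP.m∸n≤m n m) n<p) (+-cancelˡ (m ·ᴿ 1#) _ _ (begin
      m ·ᴿ 1# + (n ℕ.∸ m) ·ᴿ 1#  ≈⟨ ·ᴿ-homo-+ 1# m (n ℕ.∸ m) ⟨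
      (m ℕ.+ (n ℕ.∸ m)) ·ᴿ 1#    ≡⟨ ≡.cong (_·ᴿ 1#) (ℕP.m+[n∸m]≡n (ℕP.<⇒≤ m<n)) ⟩
      n ·ᴿ 1#                    ≈⟨ m·1≈n·1 ⟨
      m ·ᴿ 1#                    ≈⟨ +-identityʳ _ ⟨
      m ·ᴿ 1# + 0#               ∎))

    ·1-injective : ∀ {m n} → m ℕ.< p → n ℕ.< p → m ·ᴿ 1# ≈ n ·ᴿ 1# → m ≡ n
    ·1-injective {m} {n} m<p n<p m·1≈n·1 with ℕP.<-cmp m n
    ... | tri< m<n _ _ = contradiction m·1≈n·1 (·1-distinct m<n n<p)
    ... | tri≈ _ m≡n _ = m≡n
    ... | tri> _ _ n<m = contradiction (sym m·1≈n·1) (·1-distinct n<m m<p)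

    Xᵖ-X : Vec Carrier (suc p)
    Xᵖ-X = Vec.zipWith (λ a b → a + - b) (monomial (suc p) p) (monomial (suc p) 1)

    eval-Xᵖ-X : ∀ x → eval Xᵖ-X x ≈ x ^ᴿ p + - x
    eval-Xᵖ-X x = trans (eval-sub (monomial (suc p) p) (monomial (suc p) 1))
      (+-cong (eval-monomial (suc p) p x ℕP.≤-refl) (-‿cong (trans (eval-monomial (suc p) 1 x (s≤s 0<p)) (*-identityʳ x))))
      where
      eval-sub : ∀ {n} (f g : Vec Carrier n) → eval (Vec.zipWith (λ a b → a + - b) f g) x ≈ eval f x + - eval g x
      eval-sub []      []      = sym (trans (+-congˡ -0#≈0#) (+-identityʳ 0#))
      eval-sub {suc n} (a ∷ f) (b ∷ g) = trans (+-congˡ (eval-sub f g))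
        (solve 5 (λ a b X F G → (a :- b) :* X :+ (F :- G) := (a :* X :+ F) :- (b :* X :+ G)) refl a b (x ^ᴿ n) (eval f x) (eval g x))

    head-Xᵖ-X : Vec.head Xᵖ-X ≈ 1#
    head-Xᵖ-X with p ℕ.≟ p | p ℕ.≟ 1
    ... | no p≢p | _       = contradiction ≡.refl p≢p
    ... | yes _  | yes p≡1 = contradiction (≡.subst Prime p≡1 p-prime) ¬prime[1]
    ... | yes _  | no _    = trans (+-congˡ -0#≈0#) (+-identityʳ 1#)

    -- The p + 1 elements w, 0, 1, …, p - 1 would be distinct roots of Xᵖ - X.
    frobenius-fixed⇒prime-field : ∀ w → w ^ᴿ p ≈ w → ∃ λ (m : Fin p) → w ≈ toℕ m ·ᴿ 1#
    frobenius-fixed⇒prime-field w wᵖ≈w with FinP.any? (λ (m : Fin p) → ≈0? (w + - (toℕ m ·ᴿ 1#)))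
    ... | yes (m , w-m≈0) = m , x∙y⁻¹≈ε⇒x≈y _ _ w-m≈0
    ... | no  w∉𝔽ₚ = contradiction (trans (sym head-Xᵖ-X) (leadingCoefficient≈0 cancel p Xᵖ-X ζ ζ-injective ζ-root)) 1≉0
      where
      ζ : Fin (suc p) → Carrier
      ζ zero    = w
      ζ (suc m) = toℕ m ·ᴿ 1#
      ζ-injective : ∀ i j → ζ i + - ζ j ≈ 0# → i ≡ j
      ζ-injective zero    zero    _ = ≡.refl
      ζ-injective zero    (suc m) e = contradiction (m , e) w∉𝔽ₚ
      ζ-injective (suc m) zero    e = contradiction (m , x≈y⇒x∙y⁻¹≈ε (sym (x∙y⁻¹≈ε⇒x≈y _ _ e))) w∉𝔽ₚ
      ζ-injective (suc m) (suc n) e =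
        ≡.cong suc (FinP.toℕ-injective (·1-injective (FinP.toℕ<n m) (FinP.toℕ<n n) (x∙y⁻¹≈ε⇒x≈y _ _ e)))
      ζ-root : ∀ i → eval Xᵖ-X (ζ i) ≈ 0#
      ζ-root zero    = trans (eval-Xᵖ-X w) (x≈y⇒x∙y⁻¹≈ε wᵖ≈w)
      ζ-root (suc m) = trans (eval-Xᵖ-X _) (x≈y⇒x∙y⁻¹≈ε (fermat (toℕ m)))

    Independent : ∀ n → (Fin n → Carrier) → Set ℓ
    Independent n x = ∀ (a : Fin n → ℕ) → sumᴿ n (λ l → a l ·ᴿ x l) ≈ 0# → ∀ l → p ∣ a l

    independent⇒≉0 : ∀ n (x : Fin (suc n) → Carrier) → Independent (suc n) x → ¬ x zero ≈ 0#
    independent⇒≉0 n x x-independent x₀≈0 = p∤1 (x-independent (1 Vector.∷ λ _ → 0) sum≈0 zero)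
      where
      p∤1 : ¬ p ∣ 1
      p∤1 p∣1 = ¬prime[1] (≡.subst Prime (∣1⇒≡1 p∣1) p-prime)
      sum≈0 : 1 ·ᴿ x zero + sumᴿ n (λ _ → 0#) ≈ 0#
      sum≈0 = trans (+-cong (trans (+-identityʳ _) x₀≈0) (sumᴿ-zero n _ (λ _ → refl))) (+-identityˡ 0#)

    -- Subtracting each column from the next turns the first row of the Moore matrix of (1, y₁, …, yₙ)
    -- into (1, 0, …, 0) and the other entries into powers of yᵢᵖ - yᵢ.
    moore-artinSchreier : ∀ e n (y : Fin (suc n) → Carrier) → y zero ≈ 1# →
      moore e (suc n) y ≈ moore e n (λ i → y (suc i) ^ᴿ p + - y (suc i))
    moore-artinSchreier e n y y₀≈1 = begin
      moore e (suc n) y                        ≈⟨ det-differences n Y ⟨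
      det (suc n) (λ i → differences (Y i))    ≈⟨ det-cong (suc n) differences≈B ⟩
      det (suc n) B                            ≈⟨ det-firstRow n B B₀≈0 ⟩
      y zero ^ᴿ (p ^ e) * moore e n (z ∘ suc)  ≈⟨ *-congʳ (trans (^ᴿ-congˡ (p ^ e) y₀≈1) (1^ᴿ (p ^ e))) ⟩
      1# * moore e n (z ∘ suc)                 ≈⟨ *-identityˡ _ ⟩
      moore e n (z ∘ suc)                      ∎
      where
      Y : Fin (suc n) → Fin (suc n) → Carrier
      Y i j = y i ^ᴿ (p ^[ e + j ])
      z : Fin (suc n) → Carrier
      z i = y i ^ᴿ p + - y i
      z₀≈0 : z zero ≈ 0#
      z₀≈0 = trans (+-cong (trans (^ᴿ-congˡ p y₀≈1) (1^ᴿ p)) (-‿cong y₀≈1)) (-‿inverseʳ 1#)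
      B : Fin (suc n) → Fin (suc n) → Carrier
      B i zero    = y i ^ᴿ (p ^ e)
      B i (suc j) = z i ^ᴿ (p ^[ e + j ])
      B₀≈0 : ∀ j → B zero (suc j) ≈ 0#
      B₀≈0 j = trans (^ᴿ-congˡ (p ^[ e + j ]) z₀≈0) (AdditivePower.homo-0 (frobenius^[+] e j))
      differences≈B : ∀ i j → differences (Y i) j ≈ B i j
      differences≈B i zero    = refl
      differences≈B i (suc j) = begin
        y i ^ᴿ (p ^[ suc e + j ]) + - y i ^ᴿ (p ^[ e + inject₁ j ])
          ≡⟨ ≡.cong₂ (λ a b → y i ^ᴿ a + - y i ^ᴿ b) (^[suc+]≡*^[+] p e j) (^[+inject₁]≡^[+] p e j) ⟩
        y i ^ᴿ (p ℕ.* p ^[ e + j ]) + - y i ^ᴿ (p ^[ e + j ])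
          ≈⟨ +-congʳ (^ᴿ-assocʳ (y i) p (p ^[ e + j ])) ⟩
        (y i ^ᴿ p) ^ᴿ (p ^[ e + j ]) + - y i ^ᴿ (p ^[ e + j ])
          ≈⟨ AdditivePower.homo-sub (frobenius^[+] e j) (y i ^ᴿ p) (y i) ⟨
        z i ^ᴿ (p ^[ e + j ]) ∎

    independent-artinSchreier : ∀ n (x y : Fin (suc n) → Carrier) → Independent (suc n) x → (∀ i → x i ≈ y i * x zero) →
      Independent n (λ i → y (suc i) ^ᴿ p + - y (suc i))
    independent-artinSchreier n x y x-independent x≈y·x₀ a Σaz≈0 l =
      x-independent ((p ℕ.∸ toℕ m) Vector.∷ a) sum≈0 (suc l)
      where
      W = sumᴿ n (λ l → a l ·ᴿ y (suc l))
      Wᵖ≈W : W ^ᴿ p ≈ W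
      Wᵖ≈W = begin
        W ^ᴿ p                                            ≈⟨ AdditivePower.homo-sum frobenius n _ ⟩
        sumᴿ n (λ l → (a l ·ᴿ y (suc l)) ^ᴿ p)            ≈⟨ sumᴿ-cong n (λ l → AdditivePower.homo-· frobenius (a l) (y (suc l))) ⟩
        sumᴿ n (λ l → a l ·ᴿ (y (suc l) ^ᴿ p))            ≈⟨ solve 2 (λ s t → s := (s :- t) :+ t) refl _ W ⟩
        (sumᴿ n (λ l → a l ·ᴿ (y (suc l) ^ᴿ p)) + - W) + W ≈⟨ +-congʳ Σay≈Σaz ⟩
        sumᴿ n (λ l → a l ·ᴿ (y (suc l) ^ᴿ p + - y (suc l))) + W ≈⟨ +-congʳ Σaz≈0 ⟩
        0# + W                                            ≈⟨ +-identityˡ W ⟩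
        W                                                 ∎
        where
        Σay≈Σaz : sumᴿ n (λ l → a l ·ᴿ (y (suc l) ^ᴿ p)) + - W ≈ sumᴿ n (λ l → a l ·ᴿ (y (suc l) ^ᴿ p + - y (suc l)))
        Σay≈Σaz = begin
          sumᴿ n (λ l → a l ·ᴿ (y (suc l) ^ᴿ p)) + - W
            ≈⟨ +-congˡ (sumᴿ-neg n _) ⟨
          sumᴿ n (λ l → a l ·ᴿ (y (suc l) ^ᴿ p)) + sumᴿ n (λ l → - (a l ·ᴿ y (suc l)))
            ≈⟨ sumᴿ-distrib-+ n _ _ ⟨
          sumᴿ n (λ l → a l ·ᴿ (y (suc l) ^ᴿ p) + - (a l ·ᴿ y (suc l)))
            ≈⟨ sumᴿ-cong n (λ l → trans (+-congˡ (sym (·ᴿ-neg (a l) _))) (sym (·ᴿ-distrib-+ (a l) _ _))) ⟩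
          sumᴿ n (λ l → a l ·ᴿ (y (suc l) ^ᴿ p + - y (suc l))) ∎
      m = proj₁ (frobenius-fixed⇒prime-field W Wᵖ≈W)
      W≈m : W ≈ toℕ m ·ᴿ 1#
      W≈m = proj₂ (frobenius-fixed⇒prime-field W Wᵖ≈W)
      Σax≈m·x₀ : sumᴿ n (λ l → a l ·ᴿ x (suc l)) ≈ toℕ m ·ᴿ x zero
      Σax≈m·x₀ = begin
        sumᴿ n (λ l → a l ·ᴿ x (suc l))
          ≈⟨ sumᴿ-cong n (λ l → trans (·ᴿ-congʳ (a l) (x≈y·x₀ (suc l))) (sym (·ᴿ-assoc-* (a l) _ _))) ⟩
        sumᴿ n (λ l → (a l ·ᴿ y (suc l)) * x zero) ≈⟨ sumᴿ-cong n (λ l → *-comm _ (x zero)) ⟩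
        sumᴿ n (λ l → x zero * (a l ·ᴿ y (suc l))) ≈⟨ *-distribˡ-sumᴿ n (x zero) _ ⟨
        x zero * W                                ≈⟨ *-congˡ W≈m ⟩
        x zero * (toℕ m ·ᴿ 1#)                    ≈⟨ ·ᴿ-comm-* (toℕ m) (x zero) 1# ⟩
        toℕ m ·ᴿ (x zero * 1#)                    ≈⟨ ·ᴿ-congʳ (toℕ m) (*-identityʳ _) ⟩
        toℕ m ·ᴿ x zero                           ∎
      m≤p = ℕP.<⇒≤ (FinP.toℕ<n m)
      sum≈0 : (p ℕ.∸ toℕ m) ·ᴿ x zero + sumᴿ n (λ l → a l ·ᴿ x (suc l)) ≈ 0#
      sum≈0 = begin
        (p ℕ.∸ toℕ m) ·ᴿ x zero + sumᴿ n (λ l → a l ·ᴿ x (suc l)) ≈⟨ +-congˡ Σax≈m·x₀ ⟩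
        (p ℕ.∸ toℕ m) ·ᴿ x zero + toℕ m ·ᴿ x zero                ≈⟨ ·ᴿ-homo-+ (x zero) (p ℕ.∸ toℕ m) (toℕ m) ⟨
        (p ℕ.∸ toℕ m ℕ.+ toℕ m) ·ᴿ x zero                        ≡⟨ ≡.cong (_·ᴿ x zero) (ℕP.m∸n+n≡m m≤p) ⟩
        p ·ᴿ x zero                                             ≈⟨ p·ᴿx≈0 (x zero) ⟩
        0#                                                      ∎

    moore≉0 : ∀ e n (x : Fin n → Carrier) → Independent n x → ¬ moore e n x ≈ 0#
    moore≉0 e zero    x _ = 1≉0
    moore≉0 e (suc n) x x-independent =
      *-≉0 P≉0 (moore≉0 e n _ (independent-artinSchreier n x y x-independent x≈y·x₀)) ∘ trans (sym moore≈P·moore)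
      where
      x₀≉0 = independent⇒≉0 n x x-independent
      x₀⁻¹ = proj₁ (inverse (x zero) x₀≉0)
      y : Fin (suc n) → Carrier
      y i = x i * x₀⁻¹
      x≈y·x₀ : ∀ i → x i ≈ y i * x zero
      x≈y·x₀ i = trans (sym (*-identityʳ _)) (trans (*-congˡ (sym (proj₂ (inverse (x zero) x₀≉0))))
        (solve 3 (λ a b c → a :* (b :* c) := a :* c :* b) refl _ _ _))
      P = prodᴿ (suc n) (λ j → x zero ^ᴿ (p ^[ e + j ]))
      P≉0 : ¬ P ≈ 0#
      P≉0 = prodᴿ-≉0 (suc n) _ (λ j → ^ᴿ-≉0 (p ^[ e + j ]) x₀≉0)
      moore≈P·moore : moore e (suc n) x ≈ P * moore e n (λ i → y (suc i) ^ᴿ p + - y (suc i))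
      moore≈P·moore = begin
        moore e (suc n) x                         ≈⟨ moore-cong e (suc n) x≈y·x₀ ⟩
        moore e (suc n) (λ i → y i * x zero)      ≈⟨ moore-scale e (suc n) y (x zero) ⟩
        P * moore e (suc n) y                     ≈⟨ *-congˡ (moore-artinSchreier e n y (proj₂ (inverse (x zero) x₀≉0))) ⟩
        P * moore e n (λ i → y (suc i) ^ᴿ p + - y (suc i)) ∎

≤∞-trans : ∀ {x y z} → x ≤∞ y → y ≤∞ z → x ≤∞ z
≤∞-trans (fin≤fin a≤b) (fin≤fin b≤c) = fin≤fin (ℤP.≤-trans a≤b b≤c)
≤∞-trans (fin≤fin _)   (_ ≤∞∞)       = _ ≤∞∞
≤∞-trans (_ ≤∞∞)       (_ ≤∞∞)       = _ ≤∞∞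

≤∞-reflexive : ∀ {x y} → x ≡ y → x ≤∞ y
≤∞-reflexive {fin a} ≡.refl = fin≤fin ℤP.≤-refl
≤∞-reflexive {∞}     ≡.refl = ∞ ≤∞∞

≤-≤∞-trans : ∀ {a b x} → a ℤ.≤ b → fin b ≤∞ x → fin a ≤∞ x
≤-≤∞-trans a≤b = ≤∞-trans (fin≤fin a≤b)

+∞-mono-≤∞ : ∀ {a b x y} → fin a ≤∞ x → fin b ≤∞ y → fin (a ℤ.+ b) ≤∞ x +∞ y
+∞-mono-≤∞ (fin≤fin a≤x) (fin≤fin b≤y) = fin≤fin (ℤP.+-mono-≤ a≤x b≤y)
+∞-mono-≤∞ (fin≤fin _)   (_ ≤∞∞)       = _ ≤∞∞
+∞-mono-≤∞ (_ ≤∞∞)       _             = _ ≤∞∞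

min∞-glb : ∀ {a x y} → fin a ≤∞ x → fin a ≤∞ y → fin a ≤∞ min∞ x y
min∞-glb (fin≤fin a≤x) (fin≤fin a≤y) = fin≤fin (ℤP.⊓-glb a≤x a≤y)
min∞-glb (fin≤fin a≤x) (_ ≤∞∞)       = fin≤fin a≤x
min∞-glb (_ ≤∞∞)       a≤y           = a≤y

≤∞-squeeze : ∀ {a z} → fin a ≤∞ z → ¬ fin (+ 1 ℤ.+ a) ≤∞ z → z ≡ fin a
≤∞-squeeze (_ ≤∞∞) a<z = contradiction (_ ≤∞∞) a<z
≤∞-squeeze {a} (fin≤fin {b = b} a≤b) a≮z with a ℤ.≟ b
... | yes a≡b = ≡.cong fin (≡.sym a≡b)
... | no  a≢b = contradiction (fin≤fin (ℤP.i<j⇒suc[i]≤j (ℤP.≤∧≢⇒< a≤b a≢b))) a≮z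

fin-injective : ∀ {a b} → fin a ≡ fin b → a ≡ b
fin-injective ≡.refl = ≡.refl

module Valuation {c ℓ} {p} (F : LocalField c ℓ p) where
  open LocalField F hiding (zero)
  open RingOpsProperties commRing
  open ≡.≡-Reasoning
  open import Algebra.Properties.Ring ring using (-0#≈0#; -1*x≈-x; -‿involutive)
  open import Algebra.Properties.Ring ℤP.+-*-ring using () renaming (x+x≈x⇒x≈0 to i+i≡i⇒i≡0)

  v-≈0 : ∀ {x} → x ≈ 0# → v x ≡ ∞
  v-≈0 x≈0 = ≡.trans (v-cong x≈0) v-0

  ≈0⇒≤∞v : ∀ {a x} → x ≈ 0# → fin a ≤∞ v x
  ≈0⇒≤∞v x≈0 = ≡.subst (fin _ ≤∞_) (≡.sym (v-≈0 x≈0)) (_ ≤∞∞)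

  ≤∞v-cong : ∀ {a x y} → x ≈ y → fin a ≤∞ v x → fin a ≤∞ v y
  ≤∞v-cong x≈y = ≡.subst (fin _ ≤∞_) (v-cong x≈y)

  v-*-fin : ∀ {x y a b} → v x ≡ fin a → v y ≡ fin b → v (x * y) ≡ fin (a ℤ.+ b)
  v-*-fin {x} {y} vx≡a vy≡b = ≡.trans (v-mul x y) (≡.cong₂ _+∞_ vx≡a vy≡b)

  v-1 : v 1# ≡ fin (+ 0)
  v-1 with v 1# in v1≡
  ... | ∞     = contradiction (v-∞⇒0 1# v1≡) 1≉0
  ... | fin z = ≡.cong fin (i+i≡i⇒i≡0 z (fin-injective (begin
      fin (z ℤ.+ z)  ≡⟨ v-*-fin v1≡ v1≡ ⟨
      v (1# * 1#)    ≡⟨ v-cong (*-identityˡ 1#) ⟩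
      v 1#           ≡⟨ v1≡ ⟩
      fin z          ∎)))

  v-neg1 : v (- 1#) ≡ fin (+ 0)
  v-neg1 with v (- 1#) in v-1≡
  ... | ∞     = contradiction (trans (sym (-‿involutive 1#)) (trans (-‿cong (v-∞⇒0 (- 1#) v-1≡)) -0#≈0#)) 1≉0
  ... | fin z = ≡.cong fin (i+i≡0⇒i≡0 z (fin-injective (≡.trans (≡.sym (v-*-fin v-1≡ v-1≡)) (≡.trans (v-cong -1*-1≈1) v-1))))
    where
    i+i≡0⇒i≡0 : ∀ i → i ℤ.+ i ≡ + 0 → i ≡ + 0
    i+i≡0⇒i≡0 (+ zero)  _ = ≡.refl
    -1*-1≈1 : - 1# * - 1# ≈ 1#
    -1*-1≈1 = trans (-1*x≈-x (- 1#)) (-‿involutive 1#)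

  v-neg : ∀ x → v (- x) ≡ v x
  v-neg x = begin
    v (- x)           ≡⟨ v-cong (-1*x≈-x x) ⟨
    v (- 1# * x)      ≡⟨ v-mul (- 1#) x ⟩
    v (- 1#) +∞ v x   ≡⟨ ≡.cong (_+∞ v x) v-neg1 ⟩
    fin (+ 0) +∞ v x  ≡⟨ 0+∞x≡x (v x) ⟩
    v x               ∎
    where
    0+∞x≡x : ∀ x → fin (+ 0) +∞ x ≡ x
    0+∞x≡x (fin a) = ≡.cong fin (ℤP.+-identityˡ a)
    0+∞x≡x ∞       = ≡.refl

  v-^ : ∀ {x a} n → v x ≡ fin a → v (x ^ᴿ n) ≡ fin (+ n ℤ.* a)
  v-^ {x} {a} zero    vx≡a = v-1
  v-^ {x} {a} (suc n) vx≡a = ≡.trans (v-*-fin vx≡a (v-^ n vx≡a)) (≡.cong fin (≡.sym (ℤP.suc-* (+ n) a)))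

  v-prodᴿ : ∀ n (f : Fin n → Carrier) (g : Fin n → ℤ) → (∀ i → v (f i) ≡ fin (g i)) → v (prodᴿ n f) ≡ fin (sumℤ n g)
  v-prodᴿ zero    f g vf≡g = v-1
  v-prodᴿ (suc n) f g vf≡g = v-*-fin (vf≡g zero) (v-prodᴿ n (f ∘ suc) (g ∘ suc) (vf≡g ∘ suc))

  v-+-≥ : ∀ {a} x y → fin a ≤∞ v x → fin a ≤∞ v y → fin a ≤∞ v (x + y)
  v-+-≥ x y a≤vx a≤vy = ≤∞-trans (min∞-glb a≤vx a≤vy) (v-add x y)

  v-neg-≥ : ∀ {a} x → fin a ≤∞ v x → fin a ≤∞ v (- x)
  v-neg-≥ x = ≡.subst (fin _ ≤∞_) (≡.sym (v-neg x))

  v-*-≥ : ∀ {a b} x y → fin a ≤∞ v x → fin b ≤∞ v y → fin (a ℤ.+ b) ≤∞ v (x * y)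
  v-*-≥ x y a≤vx b≤vy = ≡.subst (fin _ ≤∞_) (≡.sym (v-mul x y)) (+∞-mono-≤∞ a≤vx b≤vy)

  v-altSumᴿ-≥ : ∀ {a} n (f : Fin n → Carrier) → (∀ i → fin a ≤∞ v (f i)) → fin a ≤∞ v (altSumᴿ n f)
  v-altSumᴿ-≥ zero    f a≤vf = ≈0⇒≤∞v refl
  v-altSumᴿ-≥ (suc n) f a≤vf = v-+-≥ _ _ (a≤vf zero) (v-neg-≥ _ (v-altSumᴿ-≥ n (f ∘ suc) (a≤vf ∘ suc)))

  v-*-fin⁻¹ : ∀ {x y a b} → v x ≡ fin a → v (x * y) ≡ fin b → v y ≡ fin (b ℤ.- a)
  v-*-fin⁻¹ {x} {y} {a} {b} vx≡a vxy≡b with v y in vy≡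
  ... | ∞     with ≡.trans (≡.sym (≡.trans (v-mul x y) (≡.cong₂ _+∞_ vx≡a vy≡))) vxy≡b
  ...   | ()
  v-*-fin⁻¹ {x} {y} {a} {b} vx≡a vxy≡b | fin t =
    ≡.cong fin (≡.trans (cancel a t) (≡.cong (ℤ._- a) (fin-injective (≡.trans (≡.sym (v-*-fin vx≡a vy≡)) vxy≡b))))
    where
    cancel : ∀ a t → t ≡ (a ℤ.+ t) ℤ.- a
    cancel = solve-∀

  v-altSumᴿ-↑-≥ : ∀ m n (g : Fin (m ℕ.+ n) → Carrier) (h : Fin m → Carrier) {s} →
    (∀ i → fin s ≤∞ v (g (i ↑ˡ n) + - h i)) → (∀ j → fin s ≤∞ v (g (m ↑ʳ j))) →
    fin s ≤∞ v (altSumᴿ (m ℕ.+ n) g + - altSumᴿ m h)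
  v-altSumᴿ-↑-≥ zero    n g h _ s≤vg = ≤∞v-cong (sym (trans (+-congˡ -0#≈0#) (+-identityʳ _))) (v-altSumᴿ-≥ n g s≤vg)
  v-altSumᴿ-↑-≥ (suc m) n g h s≤vg-h s≤vg = ≤∞v-cong
    (solve 4 (λ g₀ h₀ G H → (g₀ :- h₀) :+ (:- (G :- H)) := (g₀ :- G) :- (h₀ :- H)) refl (g zero) (h zero) _ _)
    (v-+-≥ _ _ (s≤vg-h zero) (v-neg-≥ _ (v-altSumᴿ-↑-≥ m n (g ∘ suc) (h ∘ suc) (s≤vg-h ∘ suc) s≤vg)))

  v-+-strict : ∀ {a} x y → v x ≡ fin a → fin (+ 1 ℤ.+ a) ≤∞ v y → v (x + y) ≡ fin a
  v-+-strict {a} x y vx≡a a<vy = ≤∞-squeeze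
    (v-+-≥ x y (≤∞-reflexive (≡.sym vx≡a)) (≤-≤∞-trans (ℤP.i≤suc[i] a) a<vy))
    (λ a<vx+y → ℤP.<-irrefl ≡.refl (ℤP.suc[i]≤j⇒i<j (fin≤fin⁻¹ (≡.subst (fin (+ 1 ℤ.+ a) ≤∞_)
       (≡.trans (v-cong (solve 2 (λ x y → x :+ y :- y := x) refl x y)) vx≡a) (v-+-≥ (x + y) (- y) a<vx+y (v-neg-≥ y a<vy))))))
    where
    fin≤fin⁻¹ : ∀ {a b} → fin a ≤∞ fin b → a ℤ.≤ b
    fin≤fin⁻¹ (fin≤fin a≤b) = a≤b

module ResidueField {c ℓ} {p} (F : LocalField c ℓ p) where
  open LocalField F hiding (zero)
  open RingOpsProperties commRing
  open DeterminantProperties commRing using (det-cong)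
  open Valuation F
  open import Relation.Binary.Reasoning.Setoid setoid
  open import Algebra.Properties.Ring ring using (-0#≈0#)

  𝒪 : Set c
  𝒪 = Σ Carrier λ x → fin (+ 0) ≤∞ v x

  infix 4 _≈𝔐_
  _≈𝔐_ : 𝒪 → 𝒪 → Set
  (x , _) ≈𝔐 (y , _) = fin (+ 1) ≤∞ v (x + - y)

  _+𝒪_ _*𝒪_ : 𝒪 → 𝒪 → 𝒪
  (x , 0≤vx) +𝒪 (y , 0≤vy) = x + y , v-+-≥ x y 0≤vx 0≤vy
  (x , 0≤vx) *𝒪 (y , 0≤vy) = x * y , v-*-≥ x y 0≤vx 0≤vy

  -𝒪_ : 𝒪 → 𝒪
  -𝒪 (x , 0≤vx) = - x , v-neg-≥ x 0≤vx

  0𝒪 1𝒪 : 𝒪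
  0𝒪 = 0# , ≈0⇒≤∞v refl
  1𝒪 = 1# , ≤∞-reflexive (≡.sym v-1)

  ≈⇒≈𝔐 : ∀ (x y : 𝒪) → proj₁ x ≈ proj₁ y → x ≈𝔐 y
  ≈⇒≈𝔐 x y x≈y = ≈0⇒≤∞v (trans (+-congʳ x≈y) (-‿inverseʳ _))

  ≈𝔐-sym : ∀ {x y} → x ≈𝔐 y → y ≈𝔐 x
  ≈𝔐-sym {x , _} {y , _} = ≤∞v-cong (solve 2 (λ x y → :- (x :- y) := y :- x) refl x y) ∘ v-neg-≥ _

  ≈𝔐-trans : ∀ {x y z} → x ≈𝔐 y → y ≈𝔐 z → x ≈𝔐 z
  ≈𝔐-trans {x , _} {y , _} {z , _} x≈y y≈z =
    ≤∞v-cong (solve 3 (λ x y z → (x :- y) :+ (y :- z) := x :- z) refl x y z) (v-+-≥ _ _ x≈y y≈z)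

  +𝒪-cong : ∀ {x x′ y y′} → x ≈𝔐 x′ → y ≈𝔐 y′ → x +𝒪 y ≈𝔐 x′ +𝒪 y′
  +𝒪-cong {x , _} {x′ , _} {y , _} {y′ , _} x≈x′ y≈y′ =
    ≤∞v-cong (solve 4 (λ x x′ y y′ → (x :- x′) :+ (y :- y′) := (x :+ y) :- (x′ :+ y′)) refl x x′ y y′) (v-+-≥ _ _ x≈x′ y≈y′)

  *𝒪-cong : ∀ {x x′ y y′} → x ≈𝔐 x′ → y ≈𝔐 y′ → x *𝒪 y ≈𝔐 x′ *𝒪 y′
  *𝒪-cong {x , 0≤vx} {x′ , _} {y , _} {y′ , 0≤vy′} x≈x′ y≈y′ =
    ≤∞v-cong (solve 4 (λ x x′ y y′ → x :* (y :- y′) :+ (x :- x′) :* y′ := x :* y :- x′ :* y′) refl x x′ y y′)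
             (v-+-≥ _ _ (v-*-≥ x _ 0≤vx y≈y′) (v-*-≥ _ y′ x≈x′ 0≤vy′))

  -𝒪-cong : ∀ {x x′} → x ≈𝔐 x′ → -𝒪 x ≈𝔐 -𝒪 x′
  -𝒪-cong {x , _} {x′ , _} = ≤∞v-cong (solve 2 (λ x x′ → :- (x :- x′) := (:- x) :- (:- x′)) refl x x′) ∘ v-neg-≥ _

  residue-isCommutativeRing : IsCommutativeRing _≈𝔐_ _+𝒪_ _*𝒪_ -𝒪_ 0𝒪 1𝒪
  residue-isCommutativeRing = record
    { isRing = record
      { +-isAbelianGroup = record
        { isGroup = record
          { isMonoid = record
            { isSemigroup = record
              { isMagma = record
                { isEquivalence = record
                  { refl  = λ {x} → ≈⇒≈𝔐 x x refl
                  ; sym   = λ {x} {y} → ≈𝔐-sym {x} {y}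
                  ; trans = λ {x} {y} {z} → ≈𝔐-trans {x} {y} {z} }
                ; ∙-cong = λ {x} {x′} {y} {y′} → +𝒪-cong {x} {x′} {y} {y′} }
              ; assoc = λ x y z → ≈⇒≈𝔐 ((x +𝒪 y) +𝒪 z) (x +𝒪 (y +𝒪 z)) (+-assoc _ _ _) }
            ; identity = (λ x → ≈⇒≈𝔐 (0𝒪 +𝒪 x) x (+-identityˡ _)) , (λ x → ≈⇒≈𝔐 (x +𝒪 0𝒪) x (+-identityʳ _)) }
          ; inverse = (λ x → ≈⇒≈𝔐 ((-𝒪 x) +𝒪 x) 0𝒪 (-‿inverseˡ _)) , (λ x → ≈⇒≈𝔐 (x +𝒪 (-𝒪 x)) 0𝒪 (-‿inverseʳ _))
          ; ⁻¹-cong = λ {x} {x′} → -𝒪-cong {x} {x′} }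
        ; comm = λ x y → ≈⇒≈𝔐 (x +𝒪 y) (y +𝒪 x) (+-comm _ _) }
      ; *-cong = λ {x} {x′} {y} {y′} → *𝒪-cong {x} {x′} {y} {y′}
      ; *-assoc = λ x y z → ≈⇒≈𝔐 ((x *𝒪 y) *𝒪 z) (x *𝒪 (y *𝒪 z)) (*-assoc _ _ _)
      ; *-identity = (λ x → ≈⇒≈𝔐 (1𝒪 *𝒪 x) x (*-identityˡ _)) , (λ x → ≈⇒≈𝔐 (x *𝒪 1𝒪) x (*-identityʳ _))
      ; distrib = (λ x y z → ≈⇒≈𝔐 (x *𝒪 (y +𝒪 z)) ((x *𝒪 y) +𝒪 (x *𝒪 z)) (distribˡ _ _ _))
                , (λ x y z → ≈⇒≈𝔐 ((y +𝒪 z) *𝒪 x) ((y *𝒪 x) +𝒪 (z *𝒪 x)) (distribʳ _ _ _)) }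
    ; *-comm = λ x y → ≈⇒≈𝔐 (x *𝒪 y) (y *𝒪 x) (*-comm _ _) }

  residueRing : CommutativeRing c Level.zero
  residueRing = record { isCommutativeRing = residue-isCommutativeRing }

  private
    module 𝒪 = RingOps residueRing

  v[x-0]≡vx : ∀ x → v (x + - 0#) ≡ v x
  v[x-0]≡vx x = v-cong (trans (+-congˡ -0#≈0#) (+-identityʳ x))

  proj₁-^ᴿ : ∀ (x : 𝒪) n → proj₁ (x 𝒪.^ᴿ n) ≡ proj₁ x ^ᴿ n
  proj₁-^ᴿ x zero    = ≡.refl
  proj₁-^ᴿ x (suc n) = ≡.cong (proj₁ x *_) (proj₁-^ᴿ x n)

  proj₁-·ᴿ : ∀ n (x : 𝒪) → proj₁ (n 𝒪.·ᴿ x) ≡ n ·ᴿ proj₁ x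
  proj₁-·ᴿ zero    x = ≡.refl
  proj₁-·ᴿ (suc n) x = ≡.cong (λ y → proj₁ x + y) (proj₁-·ᴿ n x)

  proj₁-sumᴿ : ∀ n (f : Fin n → 𝒪) → proj₁ (𝒪.sumᴿ n f) ≡ sumᴿ n (proj₁ ∘ f)
  proj₁-sumᴿ zero    f = ≡.refl
  proj₁-sumᴿ (suc n) f = ≡.cong (λ y → proj₁ (f zero) + y) (proj₁-sumᴿ n (f ∘ suc))

  proj₁-altSumᴿ : ∀ n (f : Fin n → 𝒪) → proj₁ (𝒪.altSumᴿ n f) ≡ altSumᴿ n (proj₁ ∘ f)
  proj₁-altSumᴿ zero    f = ≡.refl
  proj₁-altSumᴿ (suc n) f = ≡.cong (λ y → proj₁ (f zero) + - y) (proj₁-altSumᴿ n (f ∘ suc))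

  proj₁-det : ∀ n (A : Fin n → Fin n → 𝒪) → proj₁ (𝒪.det n A) ≈ det n (λ i j → proj₁ (A i j))
  proj₁-det zero    A = refl
  proj₁-det (suc n) A = trans (reflexive (proj₁-altSumᴿ (suc n) λ i → A i zero *𝒪 𝒪.det n (λ a b → A (punchIn i a) (suc b))))
    (altSumᴿ-cong (suc n) λ i → *-congˡ {proj₁ (A i zero)} (proj₁-det n (λ a b → A (punchIn i a) (suc b))))

  residue-char : p 𝒪.·ᴿ 1𝒪 ≈𝔐 0𝒪
  residue-char = ≡.subst (fin (+ 1) ≤∞_)
    (≡.sym (≡.trans (≡.cong (λ x → v (x + - 0#)) (proj₁-·ᴿ p 1𝒪)) (v[x-0]≡vx _))) residue-p

  residue-1≉0 : ¬ 1𝒪 ≈𝔐 0𝒪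
  residue-1≉0 1≈0 with ≡.subst (fin (+ 1) ≤∞_) (≡.trans (v[x-0]≡vx 1#) v-1) 1≈0
  ... | fin≤fin (ℤ.+≤+ ())

  residue-≈0? : ∀ x → Dec (x ≈𝔐 0𝒪)
  residue-≈0? (x , _) = 1≤∞? (v (x + - 0#))
    where
    1≤∞? : ∀ z → Dec (fin (+ 1) ≤∞ z)
    1≤∞? ∞       = yes (_ ≤∞∞)
    1≤∞? (fin a) with + 1 ℤP.≤? a
    ... | yes 1≤a = yes (fin≤fin 1≤a)
    ... | no  1≰a = no λ { (fin≤fin 1≤a) → 1≰a 1≤a }

  residue-unit : ∀ (x : 𝒪) → ¬ x ≈𝔐 0𝒪 → v (proj₁ x) ≡ fin (+ 0)
  residue-unit (x , 0≤vx) x≉0 = ≤∞-squeeze 0≤vx (x≉0 ∘ ≡.subst (fin (+ 1) ≤∞_) (≡.sym (v[x-0]≡vx x)))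

  residue-inverse : ∀ x → ¬ x ≈𝔐 0𝒪 → ∃ λ y → x *𝒪 y ≈𝔐 1𝒪
  residue-inverse x x≉0 = ȳ , ≈⇒≈𝔐 (x *𝒪 ȳ) 1𝒪 xy≈1
    where
    vx≡0 = residue-unit x x≉0
    x≉0′ : ¬ proj₁ x ≈ 0#
    x≉0′ x≈0 with ≡.trans (≡.sym (v-≈0 x≈0)) vx≡0
    ... | ()
    y = proj₁ (inverse (proj₁ x) x≉0′)
    xy≈1 = proj₂ (inverse (proj₁ x) x≉0′)
    vy≡0 : v y ≡ fin (+ 0)
    vy≡0 = v-*-fin⁻¹ vx≡0 (≡.trans (v-cong xy≈1) v-1)
    ȳ : 𝒪
    ȳ = y , ≤∞-reflexive (≡.sym vy≡0)

  v-moore-units : ∀ e n (u : Fin n → Carrier) (0≤vu : ∀ i → fin (+ 0) ≤∞ v (u i)) →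
    (∀ (a : Fin n → ℕ) → fin (+ 1) ≤∞ v (sumᴿ n (λ l → a l ·ᴿ u l)) → ∀ l → p ∣ a l) →
    v (MooreDeterminant.moore commRing p e n u) ≡ fin (+ 0)
  v-moore-units e n u 0≤vu u-independent =
    ≡.trans (v-cong (sym moore-residue)) (residue-unit (𝒪-moore.moore e n ū) (Residue.moore≉0 e n ū ū-independent))
    where
    module 𝒪-moore = MooreDeterminant residueRing p
    module Residue = FieldOfCharacteristicP residueRing p-prime residue-char residue-1≉0 residue-≈0? residue-inverse
    ū : Fin n → 𝒪
    ū i = u i , 0≤vu i
    moore-residue : proj₁ (𝒪-moore.moore e n ū) ≈ MooreDeterminant.moore commRing p e n u
    moore-residue = trans (proj₁-det n _) (det-cong n (λ i j → reflexive (proj₁-^ᴿ (ū i) (p ^[ e + j ]))))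
    ū-independent : Residue.Independent n ū
    ū-independent a Σaū≈0 = u-independent a (≡.subst (fin (+ 1) ≤∞_) (≡.trans (v[x-0]≡vx _) (v-cong Σaū≈Σau)) Σaū≈0)
      where
      Σaū≈Σau : proj₁ (𝒪.sumᴿ n (λ l → a l 𝒪.·ᴿ ū l)) ≈ sumᴿ n (λ l → a l ·ᴿ u l)
      Σaū≈Σau = trans (reflexive (proj₁-sumᴿ n _)) (sumᴿ-cong n λ l → reflexive (proj₁-·ᴿ (a l) (ū l)))

Sorted : ∀ k → (Fin k → ℤ) → Set
Sorted k r = ∀ (i j : Fin k) → i Fin.≤ j → r i ℤ.≤ r j

Sorted-punchIn : ∀ {k} (r : Fin (suc k) → ℤ) → Sorted (suc k) r → ∀ i → Sorted k (r ∘ punchIn i)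
Sorted-punchIn r r-sorted i a b a≤b = r-sorted _ _ (FinP.punchIn-mono-≤ i a b a≤b)

Sorted-↑ʳ : ∀ n {m} (r : Fin (n ℕ.+ m) → ℤ) → Sorted (n ℕ.+ m) r → Sorted m (λ j → r (n ↑ʳ j))
Sorted-↑ʳ n r r-sorted i j i≤j = r-sorted _ _ (≡.subst₂ ℕ._≤_ (≡.sym (FinP.toℕ-↑ʳ n i)) (≡.sym (FinP.toℕ-↑ʳ n j)) (ℕP.+-monoʳ-≤ n i≤j))

sumℤ-cong : ∀ n {f g : Fin n → ℤ} → (∀ i → f i ≡ g i) → sumℤ n f ≡ sumℤ n g
sumℤ-cong zero    f≗g = ≡.refl
sumℤ-cong (suc n) f≗g = ≡.cong₂ ℤ._+_ (f≗g zero) (sumℤ-cong n (f≗g ∘ suc))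

sumℤ-punchIn : ∀ n (f : Fin (suc n) → ℤ) i → sumℤ (suc n) f ≡ f i ℤ.+ sumℤ n (f ∘ punchIn i)
sumℤ-punchIn n       f zero    = ≡.refl
sumℤ-punchIn (suc n) f (suc i) = begin
  f zero ℤ.+ sumℤ (suc n) (f ∘ suc)                          ≡⟨ ≡.cong (λ t → f zero ℤ.+ t) (sumℤ-punchIn n (f ∘ suc) i) ⟩
  f zero ℤ.+ (f (suc i) ℤ.+ sumℤ n (f ∘ suc ∘ punchIn i))    ≡⟨ swap (f zero) (f (suc i)) _ ⟩
  f (suc i) ℤ.+ (f zero ℤ.+ sumℤ n (f ∘ suc ∘ punchIn i))    ∎
  where
  open ≡.≡-Reasoning
  swap : ∀ a b c → a ℤ.+ (b ℤ.+ c) ≡ b ℤ.+ (a ℤ.+ c)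
  swap = solve-∀

sumℤ-neg : ∀ n (f : Fin n → ℤ) → sumℤ n (λ i → ℤ.- f i) ≡ ℤ.- sumℤ n f
sumℤ-neg zero    f = ≡.refl
sumℤ-neg (suc n) f = ≡.trans (≡.cong (λ t → ℤ.- f zero ℤ.+ t) (sumℤ-neg n (f ∘ suc))) (≡.sym (ℤP.neg-distrib-+ (f zero) _))

0≤d*[b-a] : ∀ d {a b} → a ℤ.≤ b → + 0 ℤ.≤ + d ℤ.* (b ℤ.- a)
0≤d*[b-a] d {a} {b} a≤b = ≡.subst (ℤ._≤ + d ℤ.* (b ℤ.- a)) (ℤP.*-zeroʳ (+ d)) (ℤP.*-monoˡ-≤-nonNeg (+ d) (ℤP.i≤j⇒0≤j-i a≤b))

module Weight (p-2 : ℕ) where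

  p : ℕ
  p = 2 ℕ.+ p-2

  weight : ℕ → ∀ k → (Fin k → ℤ) → ℤ
  weight e zero    r = + 0
  weight e (suc k) r = + (p ^ e) ℤ.* r zero ℤ.+ weight (suc e) k (r ∘ suc)

  weight-cong : ∀ e k {r r′ : Fin k → ℤ} → (∀ i → r i ≡ r′ i) → weight e k r ≡ weight e k r′
  weight-cong e zero    r≗r′ = ≡.refl
  weight-cong e (suc k) r≗r′ = ≡.cong₂ (λ a b → + (p ^ e) ℤ.* a ℤ.+ b) (r≗r′ zero) (weight-cong (suc e) k (r≗r′ ∘ suc))

  weight≡sumℤ : ∀ e k (r : Fin k → ℤ) → weight e k r ≡ sumℤ k (λ j → + (p ^[ e + j ]) ℤ.* r j)
  weight≡sumℤ e zero    r = ≡.refl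
  weight≡sumℤ e (suc k) r = ≡.cong (λ t → + (p ^ e) ℤ.* r zero ℤ.+ t) (weight≡sumℤ (suc e) k (r ∘ suc))

  weight-↑ : ∀ e n m (r : Fin (n ℕ.+ m) → ℤ) →
    weight e (n ℕ.+ m) r ≡ weight e n (λ i → r (i ↑ˡ m)) ℤ.+ weight (e ℕ.+ n) m (λ j → r (n ↑ʳ j))
  weight-↑ e zero    m r = ≡.trans (≡.cong (λ e → weight e m r) (≡.sym (ℕP.+-identityʳ e))) (≡.sym (ℤP.+-identityˡ _))
  weight-↑ e (suc n) m r = begin
    + (p ^ e) ℤ.* r zero ℤ.+ weight (suc e) (n ℕ.+ m) (r ∘ suc)
      ≡⟨ ≡.cong (λ t → + (p ^ e) ℤ.* r zero ℤ.+ t) (weight-↑ (suc e) n m (r ∘ suc)) ⟩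
    + (p ^ e) ℤ.* r zero ℤ.+ (weight (suc e) n (λ i → r (suc i ↑ˡ m)) ℤ.+ weight (suc e ℕ.+ n) m (λ j → r (suc n ↑ʳ j)))
      ≡⟨ ≡.cong (λ e′ → + (p ^ e) ℤ.* r zero ℤ.+ (weight (suc e) n (λ i → r (suc i ↑ˡ m)) ℤ.+ weight e′ m (λ j → r (suc n ↑ʳ j))))
                (≡.sym (ℕP.+-suc e n)) ⟩
    + (p ^ e) ℤ.* r zero ℤ.+ (weight (suc e) n (λ i → r (suc i ↑ˡ m)) ℤ.+ weight (e ℕ.+ suc n) m (λ j → r (suc n ↑ʳ j)))
      ≡⟨ ℤP.+-assoc (+ (p ^ e) ℤ.* r zero) (weight (suc e) n (λ i → r (suc i ↑ˡ m))) (weight (e ℕ.+ suc n) m (λ j → r (suc n ↑ʳ j))) ⟨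
    weight e (suc n) (λ i → r (i ↑ˡ m)) ℤ.+ weight (e ℕ.+ suc n) m (λ j → r (suc n ↑ʳ j)) ∎
    where open ≡.≡-Reasoning

  -- Moving r i to the front costs at least (p - 1) pᵉ (r i - r 0).
  weight-punchIn-gap : ∀ k e (r : Fin (suc k) → ℤ) → Sorted (suc k) r → ∀ i →
    (+ (p ^ e) ℤ.* r i ℤ.+ weight (suc e) k (r ∘ punchIn i)) ℤ.+ + (suc p-2 ℕ.* p ^ e) ℤ.* (r i ℤ.- r zero) ℤ.≤ weight e (suc k) r
  weight-punchIn-gap k e r r-sorted zero = ℤP.≤-reflexive (no-gap (+ (p ^ e)) (+ (suc p-2 ℕ.* p ^ e)) (r zero) (weight (suc e) k (r ∘ suc)))
    where
    no-gap : ∀ c d x w → (c ℤ.* x ℤ.+ w) ℤ.+ d ℤ.* (x ℤ.- x) ≡ c ℤ.* x ℤ.+ w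
    no-gap = solve-∀
  weight-punchIn-gap (suc k) e r r-sorted (suc i) = begin
    (c ℤ.* r (suc i) ℤ.+ (p·c ℤ.* r zero ℤ.+ X)) ℤ.+ d ℤ.* (r (suc i) ℤ.- r zero)
      ≡⟨ regroup c d (r zero) (r (suc i)) X ⟩
    (p·c ℤ.* r (suc i) ℤ.+ X) ℤ.+ c ℤ.* r zero
      ≤⟨ ℤP.+-monoˡ-≤ (c ℤ.* r zero) (ℤP.≤-trans (ℤP.i≤i+j (p·c ℤ.* r (suc i) ℤ.+ X) _ {{ℤ.nonNegative gap≥0}}) IH) ⟩
    weight (suc e) (suc k) (r ∘ suc) ℤ.+ c ℤ.* r zero
      ≡⟨ ℤP.+-comm (weight (suc e) (suc k) (r ∘ suc)) (c ℤ.* r zero) ⟩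
    weight e (2 ℕ.+ k) r ∎
    where
    open ℤP.≤-Reasoning
    c = + (p ^ e)
    d = + (suc p-2 ℕ.* p ^ e)
    p·c = + (p ^ suc e)
    X = weight (2 ℕ.+ e) k (λ j → r (suc (punchIn i j)))
    regroup : ∀ c d a b X → c ℤ.* b ℤ.+ ((c ℤ.+ d) ℤ.* a ℤ.+ X) ℤ.+ d ℤ.* (b ℤ.- a) ≡ ((c ℤ.+ d) ℤ.* b ℤ.+ X) ℤ.+ c ℤ.* a
    regroup = solve-∀
    IH = weight-punchIn-gap k (suc e) (r ∘ suc) (Sorted-punchIn r r-sorted zero) i
    gap≥0 : + 0 ℤ.≤ + (suc p-2 ℕ.* p ^ suc e) ℤ.* (r (suc i) ℤ.- r (suc zero))
    gap≥0 = 0≤d*[b-a] (suc p-2 ℕ.* p ^ suc e) (r-sorted (suc zero) (suc i) (s≤s z≤n))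

  weight-punchIn : ∀ k e (r : Fin (suc k) → ℤ) → Sorted (suc k) r → ∀ i →
    + (p ^ e) ℤ.* r i ℤ.+ weight (suc e) k (r ∘ punchIn i) ℤ.≤ weight e (suc k) r
  weight-punchIn k e r r-sorted i = ℤP.≤-trans (ℤP.i≤i+j (+ (p ^ e) ℤ.* r i ℤ.+ weight (suc e) k (r ∘ punchIn i)) _ {{ℤ.nonNegative gap≥0}})
    (weight-punchIn-gap k e r r-sorted i)
    where
    gap≥0 : + 0 ℤ.≤ + (suc p-2 ℕ.* p ^ e) ℤ.* (r i ℤ.- r zero)
    gap≥0 = 0≤d*[b-a] (suc p-2 ℕ.* p ^ e) (r-sorted zero i z≤n)

  weight-punchIn-< : ∀ k e (r : Fin (suc k) → ℤ) → Sorted (suc k) r → ∀ i → r zero ℤ.< r i →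
    + 1 ℤ.+ (+ (p ^ e) ℤ.* r i ℤ.+ weight (suc e) k (r ∘ punchIn i)) ℤ.≤ weight e (suc k) r
  weight-punchIn-< k e r r-sorted i r₀<rᵢ = begin
    + 1 ℤ.+ L             ≡⟨ ℤP.+-comm (+ 1) L ⟩
    L ℤ.+ + 1             ≤⟨ ℤP.+-monoʳ-≤ L gap≥1 ⟩
    L ℤ.+ + (suc p-2 ℕ.* p ^ e) ℤ.* (r i ℤ.- r zero) ≤⟨ weight-punchIn-gap k e r r-sorted i ⟩
    weight e (suc k) r    ∎
    where
    open ℤP.≤-Reasoning
    L = + (p ^ e) ℤ.* r i ℤ.+ weight (suc e) k (r ∘ punchIn i)
    d = + (suc p-2 ℕ.* p ^ e)
    1≤d : + 1 ℤ.≤ d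
    1≤d = ℤ.+≤+ (ℕP.≤-trans (ℕP.m^n>0 p e) (ℕP.m≤n*m (p ^ e) (suc p-2)))
    1≤rᵢ-r₀ : + 1 ℤ.≤ r i ℤ.- r zero
    1≤rᵢ-r₀ = ≡.subst (ℤ._≤ r i ℤ.- r zero) (cancel (r zero)) (ℤP.+-monoˡ-≤ (ℤ.- r zero) (ℤP.i<j⇒suc[i]≤j r₀<rᵢ))
      where
      cancel : ∀ a → (+ 1 ℤ.+ a) ℤ.- a ≡ + 1
      cancel = solve-∀
    gap≥1 : + 1 ℤ.≤ d ℤ.* (r i ℤ.- r zero)
    gap≥1 = begin
      + 1                       ≤⟨ 1≤d ⟩
      d                         ≡⟨ ℤP.*-identityʳ d ⟨
      d ℤ.* + 1                 ≤⟨ ℤP.*-monoˡ-≤-nonNeg d 1≤rᵢ-r₀ ⟩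
      d ℤ.* (r i ℤ.- r zero)    ∎

  permutation-weight-≤ : ∀ k e (σ : Permutation′ k) (r : Fin k → ℤ) → Sorted k r →
    sumℤ k (λ i → + (p ^[ e + σ ⟨$⟩ʳ i ]) ℤ.* r i) ℤ.≤ weight e k r
  permutation-weight-≤ zero    e σ r _        = ℤP.≤-refl
  permutation-weight-≤ (suc k) e σ r r-sorted = begin
    sumℤ (suc k) f                                            ≡⟨ sumℤ-punchIn k f i₀ ⟩
    f i₀ ℤ.+ sumℤ k (f ∘ punchIn i₀)                          ≤⟨ ℤP.+-mono-≤ (ℤP.≤-reflexive f-i₀) rest ⟩
    + (p ^ e) ℤ.* r i₀ ℤ.+ weight (suc e) k (r ∘ punchIn i₀)  ≤⟨ weight-punchIn k e r r-sorted i₀ ⟩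
    weight e (suc k) r                                        ∎
    where
    open ℤP.≤-Reasoning
    f : Fin (suc k) → ℤ
    f i = + (p ^[ e + σ ⟨$⟩ʳ i ]) ℤ.* r i
    i₀ = σ ⟨$⟩ˡ zero
    f-i₀ : f i₀ ≡ + (p ^ e) ℤ.* r i₀
    f-i₀ = ≡.cong (λ j → + (p ^[ e + j ]) ℤ.* r i₀) (inverseʳ σ)
    rest : sumℤ k (f ∘ punchIn i₀) ℤ.≤ weight (suc e) k (r ∘ punchIn i₀)
    rest = ℤP.≤-trans
      (ℤP.≤-reflexive (sumℤ-cong k λ j → ≡.cong (λ t → + (p ^[ e + t ]) ℤ.* r (punchIn i₀ j)) (punchIn-permute′ σ zero j)))
      (permutation-weight-≤ k (suc e) (remove i₀ σ) (r ∘ punchIn i₀) (Sorted-punchIn r r-sorted i₀))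

  weight₀≡sumℤ : ∀ k (r : Fin k → ℤ) → weight 0 k r ≡ sumℤ k (λ j → + (p ^ toℕ j) ℤ.* r j)
  weight₀≡sumℤ k r = ≡.trans (weight≡sumℤ 0 k r) (sumℤ-cong k λ j → ≡.cong (λ q → + q ℤ.* r j) (^[+]≡^ p 0 j))

  sumℤ-permute-≤ : ∀ k (σ : Permutation′ k) (r : Fin k → ℤ) → Sorted k r →
    sumℤ k (λ i → + (p ^ toℕ (σ ⟨$⟩ʳ i)) ℤ.* r i) ℤ.≤ sumℤ k (λ j → + (p ^ toℕ j) ℤ.* r j)
  sumℤ-permute-≤ k σ r r-sorted = begin
    sumℤ k (λ i → + (p ^ toℕ (σ ⟨$⟩ʳ i)) ℤ.* r i)   ≡⟨ sumℤ-cong k (λ i → ≡.cong (λ q → + q ℤ.* r i) (^[+]≡^ p 0 (σ ⟨$⟩ʳ i))) ⟨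
    sumℤ k (λ i → + (p ^[ 0 + σ ⟨$⟩ʳ i ]) ℤ.* r i)  ≤⟨ permutation-weight-≤ k 0 σ r r-sorted ⟩
    weight 0 k r                                    ≡⟨ weight₀≡sumℤ k r ⟩
    sumℤ k (λ j → + (p ^ toℕ j) ℤ.* r j)            ∎
    where open ℤP.≤-Reasoning

data LeadingBlock : ∀ {k} → (Fin k → ℤ) → Set where
  leadingBlock : ∀ n m {r : Fin (suc n ℕ.+ m) → ℤ} → (∀ i → r (i ↑ˡ m) ≡ r zero) →
    (∀ i j → r (i ↑ˡ m) ℤ.< r (suc n ↑ʳ j)) → LeadingBlock r

leadingBlock-of : ∀ k (r : Fin (suc k) → ℤ) → Sorted (suc k) r → LeadingBlock r
leadingBlock-of zero    r r-sorted = leadingBlock 0 0 (λ { zero → ≡.refl }) (λ _ ())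
leadingBlock-of (suc k) r r-sorted with r zero ℤ.≟ r (suc zero)
... | no r₀≢r₁ = leadingBlock 0 (suc k) (λ { zero → ≡.refl }) λ { zero j →
      ℤP.<-≤-trans (ℤP.≤∧≢⇒< (r-sorted zero (suc zero) z≤n) r₀≢r₁) (r-sorted (suc zero) (suc j) (s≤s z≤n)) }
... | yes r₀≡r₁ with leadingBlock-of k (r ∘ suc) (Sorted-punchIn r r-sorted zero)
...   | leadingBlock n m r-block block<rest = leadingBlock (suc n) m r-block′ block<rest′
  where
  r-block′ : ∀ i → r (i ↑ˡ m) ≡ r zero
  r-block′ zero    = ≡.refl
  r-block′ (suc i) = ≡.trans (r-block i) (≡.sym r₀≡r₁)
  block<rest′ : ∀ i j → r (i ↑ˡ m) ℤ.< r (suc (suc n) ↑ʳ j)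
  block<rest′ zero    j = ≡.subst (ℤ._< r (suc (suc n) ↑ʳ j)) (≡.sym r₀≡r₁) (block<rest zero j)
  block<rest′ (suc i) j = block<rest i j

neg-≤-+ : ∀ a b {c} → a ℤ.+ b ℤ.≤ c → ℤ.- c ℤ.≤ ℤ.- a ℤ.+ ℤ.- b
neg-≤-+ a b {c} a+b≤c = ≡.subst (ℤ.- c ℤ.≤_) (ℤP.neg-distrib-+ a b) (ℤP.neg-mono-≤ a+b≤c)

1-neg-≤-+ : ∀ a b {c} → a ℤ.+ b ℤ.≤ c → + 1 ℤ.- c ℤ.≤ ℤ.- a ℤ.+ (+ 1 ℤ.- b)
1-neg-≤-+ a b {c} a+b≤c = ≡.subst (+ 1 ℤ.- c ℤ.≤_) (regroup a b) (ℤP.+-monoʳ-≤ (+ 1) (neg-≤-+ a b a+b≤c))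
  where
  regroup : ∀ a b → + 1 ℤ.+ (ℤ.- a ℤ.+ ℤ.- b) ≡ ℤ.- a ℤ.+ (+ 1 ℤ.- b)
  regroup = solve-∀

1-neg-<-+ : ∀ a b {c} → + 1 ℤ.+ (a ℤ.+ b) ℤ.≤ c → + 1 ℤ.- c ℤ.≤ ℤ.- a ℤ.+ ℤ.- b
1-neg-<-+ a b {c} 1+a+b≤c = ≡.subst (+ 1 ℤ.- c ℤ.≤_) (cancel a b) (ℤP.+-monoʳ-≤ (+ 1) (ℤP.neg-mono-≤ 1+a+b≤c))
  where
  cancel : ∀ a b → + 1 ℤ.+ ℤ.- (+ 1 ℤ.+ (a ℤ.+ b)) ≡ ℤ.- a ℤ.+ ℤ.- b
  cancel = solve-∀

punchIn-↑ˡ : ∀ {n} m (i : Fin (suc n)) (a : Fin n) → punchIn (i ↑ˡ m) (a ↑ˡ m) ≡ punchIn i a ↑ˡ m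
punchIn-↑ˡ m zero    a       = ≡.refl
punchIn-↑ˡ m (suc i) zero    = ≡.refl
punchIn-↑ˡ m (suc i) (suc a) = ≡.cong suc (punchIn-↑ˡ m i a)

punchIn-↑ˡ-↑ʳ : ∀ {n} m (i : Fin (suc n)) (j : Fin m) → punchIn (i ↑ˡ m) (n ↑ʳ j) ≡ suc n ↑ʳ j
punchIn-↑ˡ-↑ʳ         m zero    j = ≡.refl
punchIn-↑ˡ-↑ʳ {suc n} m (suc i) j = ≡.cong suc (punchIn-↑ˡ-↑ʳ m i j)

↑ʳ-mono-< : ∀ N {m} {i j : Fin m} → i Fin.< j → N ↑ʳ i Fin.< N ↑ʳ j
↑ʳ-mono-< zero    i<j = i<j
↑ʳ-mono-< (suc N) i<j = s≤s (↑ʳ-mono-< N i<j)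

↑ʳ-mono-≤ : ∀ N {m} {i j : Fin m} → i Fin.≤ j → N ↑ʳ i Fin.≤ N ↑ʳ j
↑ʳ-mono-≤ zero    i≤j = i≤j
↑ʳ-mono-≤ (suc N) i≤j = s≤s (↑ʳ-mono-≤ N i≤j)

↑ʳ-cancel-< : ∀ N {m} {i j : Fin m} → N ↑ʳ i Fin.< N ↑ʳ j → i Fin.< j
↑ʳ-cancel-< zero    i<j       = i<j
↑ʳ-cancel-< (suc N) (s≤s i<j) = ↑ʳ-cancel-< N i<j

padˡ : ∀ N {m} → (Fin m → ℕ) → Fin (N ℕ.+ m) → ℕ
padˡ zero    a l       = a l
padˡ (suc N) a zero    = 0
padˡ (suc N) a (suc l) = padˡ N a l

padˡ-↑ʳ : ∀ N {m} (a : Fin m → ℕ) l → padˡ N a (N ↑ʳ l) ≡ a l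
padˡ-↑ʳ zero    a l = ≡.refl
padˡ-↑ʳ (suc N) a l = padˡ-↑ʳ N a l

padˡ-≡0 : ∀ N {m} (a : Fin m → ℕ) l → (∀ l′ → N ↑ʳ l′ ≡ l → a l′ ≡ 0) → padˡ N a l ≡ 0
padˡ-≡0 zero    a l       a≡0 = a≡0 l ≡.refl
padˡ-≡0 (suc N) a zero    a≡0 = ≡.refl
padˡ-≡0 (suc N) a (suc l) a≡0 = padˡ-≡0 N a l (λ l′ e → a≡0 l′ (≡.cong suc e))

padʳ : ∀ {n} m → (Fin n → ℕ) → Fin (n ℕ.+ m) → ℕ
padʳ {zero}  m a l       = 0
padʳ {suc n} m a zero    = a zero
padʳ {suc n} m a (suc l) = padʳ m (a ∘ suc) l

padʳ-↑ˡ : ∀ {n} m (a : Fin n → ℕ) i → padʳ m a (i ↑ˡ m) ≡ a i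
padʳ-↑ˡ m a zero    = ≡.refl
padʳ-↑ˡ m a (suc i) = padʳ-↑ˡ m (a ∘ suc) i

padʳ-≡0 : ∀ {n} m (a : Fin n → ℕ) l → n ℕ.≤ toℕ l → padʳ m a l ≡ 0
padʳ-≡0 {zero}  m a l       _         = ≡.refl
padʳ-≡0 {suc n} m a (suc l) (s≤s n≤l) = padʳ-≡0 m (a ∘ suc) l n≤l

module MooreValuation {c ℓ} (p-2 : ℕ) (F : LocalField c ℓ (2 ℕ.+ p-2)) where
  open LocalField F hiding (zero)
  open RingOpsProperties commRing
  open Weight p-2
  open MooreDeterminant commRing p
  open Valuation F
  open ResidueField F using (v-moore-units)
  open import Relation.Binary.Reasoning.Setoid setoid
  open import Algebra.Properties.Ring ring using (-0#≈0#)

  HasValuations : ∀ k → (Fin k → Carrier) → (Fin k → ℤ) → Set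
  HasValuations k β r = ∀ i → v (β i) ≡ fin (ℤ.- r i)

  -- The theorem's hypothesis: the residues of each run of equal valuations are 𝔽ₚ-independent.
  ResiduallyIndependent : ∀ k → (Fin k → Carrier) → (Fin k → ℤ) → Set
  ResiduallyIndependent k β r = ∀ (i j : Fin k) → i Fin.< j → r i ≡ r j →
    ∀ (a : Fin k → ℕ) → (∀ l → l Fin.< i ⊎ j Fin.< l → a l ≡ 0) →
    fin (+ 1 ℤ.- r i) ≤∞ v (sumᴿ k (λ l → a l ·ᴿ β l)) →
    ∀ l → i Fin.≤ l → l Fin.≤ j → p ∣ a l

  moore-≡ : ∀ {e e′} k {β β′ : Fin k → Carrier} → e ≡ e′ → (∀ i → β i ≡ β′ i) → moore e k β ≈ moore e′ k β′
  moore-≡ k ≡.refl β≗β′ = moore-cong _ k (reflexive ∘ β≗β′)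

  v-^p^ : ∀ {x s} e → v x ≡ fin (ℤ.- s) → v (x ^ᴿ (p ^ e)) ≡ fin (ℤ.- (+ (p ^ e) ℤ.* s))
  v-^p^ {x} {s} e vx≡-s = ≡.trans (v-^ (p ^ e) vx≡-s) (≡.cong fin (≡.sym (ℤP.neg-distribʳ-* (+ (p ^ e)) s)))

  v-moore-≥ : ∀ k e (β : Fin k → Carrier) (r : Fin k → ℤ) → HasValuations k β r → Sorted k r →
    fin (ℤ.- weight e k r) ≤∞ v (moore e k β)
  v-moore-≥ zero    e β r _     _        = ≤∞-reflexive (≡.sym v-1)
  v-moore-≥ (suc k) e β r β-val r-sorted = v-altSumᴿ-≥ (suc k) _ λ i →
    ≤-≤∞-trans (neg-≤-+ (+ (p ^ e) ℤ.* r i) (weight (suc e) k (r ∘ punchIn i)) (weight-punchIn k e r r-sorted i))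
      (v-*-≥ _ _ (≤∞-reflexive (≡.sym (v-^p^ e (β-val i))))
        (v-moore-≥ k (suc e) (β ∘ punchIn i) (r ∘ punchIn i) (β-val ∘ punchIn i) (Sorted-punchIn r r-sorted i)))

  v-moore-split : ∀ n m e (β : Fin (n ℕ.+ m) → Carrier) (r : Fin (n ℕ.+ m) → ℤ) → HasValuations _ β r → Sorted _ r →
    (∀ i j → r (i ↑ˡ m) ℤ.< r (n ↑ʳ j)) →
    fin (+ 1 ℤ.- weight e (n ℕ.+ m) r) ≤∞
      v (moore e (n ℕ.+ m) β + - (moore e n (λ i → β (i ↑ˡ m)) * moore (e ℕ.+ n) m (λ j → β (n ↑ʳ j))))
  v-moore-split zero m e β r _ _ _ =
    ≈0⇒≤∞v (trans (+-congˡ (-‿cong (trans (*-identityˡ _) (moore-≡ m (ℕP.+-identityʳ e) (λ _ → ≡.refl))))) (-‿inverseʳ _))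
  v-moore-split (suc n) m e β r β-val r-sorted block<rest = ≤∞v-cong
    (+-congˡ (-‿cong (trans (altSumᴿ-cong (suc n) (λ i → *-comm (f i) D₂))
                            (trans (sym (*-distribˡ-altSumᴿ (suc n) D₂ f)) (*-comm D₂ _)))))
    (v-altSumᴿ-↑-≥ (suc n) m g (λ i → f i * D₂) block-row rest-row)
    where
    W = weight e (suc n ℕ.+ m) r
    D₂ = moore (e ℕ.+ suc n) m (λ j → β (suc n ↑ʳ j))
    g : Fin (suc n ℕ.+ m) → Carrier
    g i = β i ^ᴿ (p ^ e) * moore (suc e) (n ℕ.+ m) (β ∘ punchIn i)
    f : Fin (suc n) → Carrier
    f i = β (i ↑ˡ m) ^ᴿ (p ^ e) * moore (suc e) n (λ a → β (punchIn i a ↑ˡ m))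
    block-row : ∀ i → fin (+ 1 ℤ.- W) ≤∞ v (g (i ↑ˡ m) + - (f i * D₂))
    block-row i = ≤∞v-cong
      (solve 4 (λ b X Y Z → b :* (X :- Y :* Z) := b :* X :- (b :* Y) :* Z) refl (β (i ↑ˡ m) ^ᴿ (p ^ e)) _ _ D₂)
      (≤-≤∞-trans (1-neg-≤-+ (+ (p ^ e) ℤ.* r (i ↑ˡ m)) (weight (suc e) (n ℕ.+ m) (r ∘ punchIn (i ↑ˡ m)))
                             (weight-punchIn (n ℕ.+ m) e r r-sorted (i ↑ˡ m)))
        (v-*-≥ _ _ (≤∞-reflexive (≡.sym (v-^p^ e (β-val (i ↑ˡ m)))))
          (≤∞v-cong (+-congˡ (-‿cong (*-cong (moore-≡ n ≡.refl (λ a → ≡.cong β (punchIn-↑ˡ m i a)))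
                                             (moore-≡ m (≡.sym (ℕP.+-suc e n)) (λ j → ≡.cong β (punchIn-↑ˡ-↑ʳ m i j))))))
            (v-moore-split n m (suc e) (β ∘ punchIn (i ↑ˡ m)) (r ∘ punchIn (i ↑ˡ m)) (β-val ∘ punchIn (i ↑ˡ m))
              (Sorted-punchIn r r-sorted (i ↑ˡ m))
              (λ a j → ≡.subst₂ ℤ._<_ (≡.cong r (≡.sym (punchIn-↑ˡ m i a))) (≡.cong r (≡.sym (punchIn-↑ˡ-↑ʳ m i j)))
                                      (block<rest (punchIn i a) j))))))
    rest-row : ∀ j → fin (+ 1 ℤ.- W) ≤∞ v (g (suc n ↑ʳ j))
    rest-row j = ≤-≤∞-trans (1-neg-<-+ (+ (p ^ e) ℤ.* r (suc n ↑ʳ j)) (weight (suc e) (n ℕ.+ m) (r ∘ punchIn (suc n ↑ʳ j)))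
                   (weight-punchIn-< (n ℕ.+ m) e r r-sorted (suc n ↑ʳ j) (block<rest zero j)))
      (v-*-≥ _ _ (≤∞-reflexive (≡.sym (v-^p^ e (β-val (suc n ↑ʳ j)))))
        (v-moore-≥ (n ℕ.+ m) (suc e) (β ∘ punchIn (suc n ↑ʳ j)) (r ∘ punchIn (suc n ↑ʳ j)) (β-val ∘ punchIn (suc n ↑ʳ j))
                   (Sorted-punchIn r r-sorted (suc n ↑ʳ j))))

  -- Scaling by an element of valuation ρ turns the entries into units.
  v-moore-block : ∀ n e (β : Fin n → Carrier) ρ → (∀ i → v (β i) ≡ fin (ℤ.- ρ)) →
    (∀ (a : Fin n → ℕ) → fin (+ 1 ℤ.- ρ) ≤∞ v (sumᴿ n (λ l → a l ·ᴿ β l)) → ∀ l → p ∣ a l) →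
    v (moore e n β) ≡ fin (ℤ.- weight e n (λ _ → ρ))
  v-moore-block n e β ρ β-val β-independent = ≡.trans
    (v-*-fin⁻¹ vΠϖ (≡.trans (v-cong (sym (moore-scale e n β ϖ))) (v-moore-units e n u 0≤vu u-independent)))
    (≡.cong fin (≡.trans (ℤP.+-identityˡ _) (≡.cong ℤ.-_ (≡.sym (weight≡sumℤ e n (λ _ → ρ))))))
    where
    ϖ = proj₁ (v-surj ρ)
    vϖ≡ρ = proj₂ (v-surj ρ)
    u : Fin n → Carrier
    u i = β i * ϖ
    0≤vu : ∀ i → fin (+ 0) ≤∞ v (u i)
    0≤vu i = ≤∞-reflexive (≡.sym (≡.trans (v-*-fin (β-val i) vϖ≡ρ) (≡.cong fin (ℤP.+-inverseˡ ρ))))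
    vΠϖ : v (prodᴿ n (λ j → ϖ ^ᴿ (p ^[ e + j ]))) ≡ fin (sumℤ n (λ j → + (p ^[ e + j ]) ℤ.* ρ))
    vΠϖ = v-prodᴿ n _ _ (λ j → v-^ (p ^[ e + j ]) vϖ≡ρ)
    u-independent : ∀ (a : Fin n → ℕ) → fin (+ 1) ≤∞ v (sumᴿ n (λ l → a l ·ᴿ u l)) → ∀ l → p ∣ a l
    u-independent a 1≤vΣau = β-independent a (shift (≡.subst (fin (+ 1) ≤∞_)
      (≡.trans (v-cong Σau≈Σaβ·ϖ) (≡.trans (v-mul _ ϖ) (≡.cong (v (sumᴿ n (λ l → a l ·ᴿ β l)) +∞_) vϖ≡ρ))) 1≤vΣau))
      where
      Σau≈Σaβ·ϖ : sumᴿ n (λ l → a l ·ᴿ u l) ≈ sumᴿ n (λ l → a l ·ᴿ β l) * ϖ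
      Σau≈Σaβ·ϖ = begin
        sumᴿ n (λ l → a l ·ᴿ (β l * ϖ))    ≈⟨ sumᴿ-cong n (λ l → trans (sym (·ᴿ-assoc-* (a l) (β l) ϖ)) (*-comm _ ϖ)) ⟩
        sumᴿ n (λ l → ϖ * (a l ·ᴿ β l))    ≈⟨ *-distribˡ-sumᴿ n ϖ _ ⟨
        ϖ * sumᴿ n (λ l → a l ·ᴿ β l)      ≈⟨ *-comm ϖ _ ⟩
        sumᴿ n (λ l → a l ·ᴿ β l) * ϖ      ∎
      shift : ∀ {x} → fin (+ 1) ≤∞ x +∞ fin ρ → fin (+ 1 ℤ.- ρ) ≤∞ x
      shift {∞}     _              = _ ≤∞∞
      shift {fin s} (fin≤fin 1≤s+ρ) = fin≤fin (≡.subst (+ 1 ℤ.- ρ ℤ.≤_) (cancel s ρ) (ℤP.+-monoˡ-≤ (ℤ.- ρ) 1≤s+ρ))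
        where
        cancel : ∀ s ρ → s ℤ.+ ρ ℤ.- ρ ≡ s
        cancel = solve-∀

  ResiduallyIndependent-↑ʳ : ∀ N m (β : Fin (N ℕ.+ m) → Carrier) r → ResiduallyIndependent (N ℕ.+ m) β r →
    ResiduallyIndependent m (λ j → β (N ↑ʳ j)) (λ j → r (N ↑ʳ j))
  ResiduallyIndependent-↑ʳ N m β r β-independent i j i<j rᵢ≡rⱼ a a-support bound l i≤l l≤j =
    ≡.subst (p ∣_) (padˡ-↑ʳ N a l)
      (β-independent (N ↑ʳ i) (N ↑ʳ j) (↑ʳ-mono-< N i<j) rᵢ≡rⱼ (padˡ N a)
        (λ l′ out → padˡ-≡0 N a l′ (λ l″ N↑ʳl″≡l′ → a-support l″ (outside out N↑ʳl″≡l′)))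
        (≤∞v-cong (sym (sum-padˡ N β)) bound)
        (N ↑ʳ l) (↑ʳ-mono-≤ N i≤l) (↑ʳ-mono-≤ N l≤j))
    where
    outside : ∀ {l′ l″} → l′ Fin.< N ↑ʳ i ⊎ N ↑ʳ j Fin.< l′ → N ↑ʳ l″ ≡ l′ → l″ Fin.< i ⊎ j Fin.< l″
    outside (inj₁ l′<i) ≡.refl = inj₁ (↑ʳ-cancel-< N l′<i)
    outside (inj₂ j<l′) ≡.refl = inj₂ (↑ʳ-cancel-< N j<l′)
    sum-padˡ : ∀ N (β : Fin (N ℕ.+ m) → Carrier) →
      sumᴿ (N ℕ.+ m) (λ l → padˡ N a l ·ᴿ β l) ≈ sumᴿ m (λ l → a l ·ᴿ β (N ↑ʳ l))
    sum-padˡ zero    β = refl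
    sum-padˡ (suc N) β = trans (+-identityˡ _) (sum-padˡ N (β ∘ suc))

  ResiduallyIndependent-block : ∀ n m (β : Fin (2 ℕ.+ n ℕ.+ m) → Carrier) r → ResiduallyIndependent (2 ℕ.+ n ℕ.+ m) β r →
    (∀ i → r (i ↑ˡ m) ≡ r zero) →
    ∀ (a : Fin (2 ℕ.+ n) → ℕ) → fin (+ 1 ℤ.- r zero) ≤∞ v (sumᴿ (2 ℕ.+ n) (λ l → a l ·ᴿ β (l ↑ˡ m))) → ∀ l → p ∣ a l
  ResiduallyIndependent-block n m β r β-independent r-block a bound l =
    ≡.subst (p ∣_) (padʳ-↑ˡ m a l)
      (β-independent first last (s≤s z≤n) (≡.sym (r-block (fromℕ (suc n)))) (padʳ m a) a-support
        (≤∞v-cong (sym (sum-padʳ m a β)) bound) (l ↑ˡ m) z≤n l≤last)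
    where
    first last : Fin (2 ℕ.+ n ℕ.+ m)
    first = zero
    last  = fromℕ (suc n) ↑ˡ m
    toℕ-last : toℕ last ≡ suc n
    toℕ-last = ≡.trans (FinP.toℕ-↑ˡ (fromℕ (suc n)) m) (FinP.toℕ-fromℕ (suc n))
    l≤last : l ↑ˡ m Fin.≤ last
    l≤last = ≡.subst₂ ℕ._≤_ (≡.sym (FinP.toℕ-↑ˡ l m)) (≡.sym toℕ-last) (FinP.toℕ≤pred[n] l)
    a-support : ∀ l′ → l′ Fin.< first ⊎ last Fin.< l′ → padʳ m a l′ ≡ 0
    a-support l′ (inj₂ last<l′) = padʳ-≡0 m a l′ (≡.subst (λ t → suc t ℕ.≤ toℕ l′) toℕ-last last<l′)
    sum-padʳ : ∀ {n} m (a : Fin n → ℕ) (β : Fin (n ℕ.+ m) → Carrier) →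
      sumᴿ (n ℕ.+ m) (λ l → padʳ m a l ·ᴿ β l) ≈ sumᴿ n (λ l → a l ·ᴿ β (l ↑ˡ m))
    sum-padʳ {zero}  m a β = sumᴿ-zero m _ (λ _ → refl)
    sum-padʳ {suc n} m a β = +-congˡ (sum-padʳ m (a ∘ suc) (β ∘ suc))

  v-moore-leadingBlock : ∀ n m e (β : Fin (suc n ℕ.+ m) → Carrier) r → HasValuations _ β r →
    ResiduallyIndependent _ β r → (∀ i → r (i ↑ˡ m) ≡ r zero) →
    v (moore e (suc n) (λ i → β (i ↑ˡ m))) ≡ fin (ℤ.- weight e (suc n) (λ i → r (i ↑ˡ m)))
  v-moore-leadingBlock zero    m e β r β-val β-independent r-block = ≡.trans
    (v-cong (trans (+-congˡ -0#≈0#) (trans (+-identityʳ _) (*-identityʳ _))))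
    (≡.trans (v-^p^ e (β-val zero)) (≡.cong (fin ∘ ℤ.-_) (≡.sym (ℤP.+-identityʳ _))))
  v-moore-leadingBlock (suc n) m e β r β-val β-independent r-block = ≡.trans
    (v-moore-block (2 ℕ.+ n) e (λ i → β (i ↑ˡ m)) (r zero) (λ i → ≡.trans (β-val (i ↑ˡ m)) (≡.cong (fin ∘ ℤ.-_) (r-block i)))
                   (ResiduallyIndependent-block n m β r β-independent r-block))
    (≡.cong (fin ∘ ℤ.-_) (weight-cong e (2 ℕ.+ n) (≡.sym ∘ r-block)))

  v-moore-blocks : ∀ n m e (β : Fin (suc n ℕ.+ m) → Carrier) r → HasValuations _ β r → Sorted _ r →
    ResiduallyIndependent _ β r → (∀ i → r (i ↑ˡ m) ≡ r zero) → (∀ i j → r (i ↑ˡ m) ℤ.< r (suc n ↑ʳ j)) →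
    v (moore (e ℕ.+ suc n) m (λ j → β (suc n ↑ʳ j))) ≡ fin (ℤ.- weight (e ℕ.+ suc n) m (λ j → r (suc n ↑ʳ j))) →
    v (moore e (suc n ℕ.+ m) β) ≡ fin (ℤ.- weight e (suc n ℕ.+ m) r)
  v-moore-blocks n m e β r β-val r-sorted β-independent r-block block<rest v-rest = ≡.trans
    (v-cong (solve 2 (λ x y → x := y :+ (x :- y)) refl _ (D₁ * D₂)))
    (v-+-strict (D₁ * D₂) _ vD₁D₂ (v-moore-split (suc n) m e β r β-val r-sorted block<rest))
    where
    D₁ = moore e (suc n) (λ i → β (i ↑ˡ m))
    D₂ = moore (e ℕ.+ suc n) m (λ j → β (suc n ↑ʳ j))
    vD₁D₂ : v (D₁ * D₂) ≡ fin (ℤ.- weight e (suc n ℕ.+ m) r)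
    vD₁D₂ = ≡.trans (v-*-fin (v-moore-leadingBlock n m e β r β-val β-independent r-block) v-rest)
      (≡.cong fin (≡.trans (≡.sym (ℤP.neg-distrib-+ W₁ W₂)) (≡.cong ℤ.-_ (≡.sym (weight-↑ e (suc n) m r)))))
      where
      W₁ = weight e (suc n) (λ i → r (i ↑ˡ m))
      W₂ = weight (e ℕ.+ suc n) m (λ j → r (suc n ↑ʳ j))

  MooreValuationFormula : ℕ → Set c
  MooreValuationFormula k = ∀ e (β : Fin k → Carrier) r → HasValuations k β r → Sorted k r → ResiduallyIndependent k β r →
    v (moore e k β) ≡ fin (ℤ.- weight e k r)

  v-moore : ∀ k → MooreValuationFormula k
  v-moore = <-rec MooreValuationFormula step
    where
    step : ∀ k → (∀ {k′} → k′ ℕ.< k → MooreValuationFormula k′) → MooreValuationFormula k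
    step zero    _      e β r _     _        _             = v-1
    step (suc k) v-rest e β r β-val r-sorted β-independent with leadingBlock-of k r r-sorted
    ... | leadingBlock n m r-block block<rest =
      v-moore-blocks n m e β r β-val r-sorted β-independent r-block block<rest
        (v-rest (s≤s (ℕP.m≤n+m m n)) (e ℕ.+ suc n) (λ j → β (suc n ↑ʳ j)) (λ j → r (suc n ↑ʳ j)) (β-val ∘ (suc n ↑ʳ_))
                (Sorted-↑ʳ (suc n) r r-sorted) (ResiduallyIndependent-↑ʳ (suc n) m β r β-independent))

  v-prodᴿ-^ : ∀ k (β : Fin k → Carrier) r (g : Fin k → ℕ) → HasValuations k β r →
    v (prodᴿ k (λ i → β i ^ᴿ g i)) ≡ fin (ℤ.- sumℤ k (λ i → + g i ℤ.* r i))
  v-prodᴿ-^ k β r g β-val = ≡.trans (v-prodᴿ k _ (λ i → + g i ℤ.* ℤ.- r i) (λ i → v-^ (g i) (β-val i)))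
    (≡.cong fin (≡.trans (sumℤ-cong k (λ i → ≡.sym (ℤP.neg-distribʳ-* (+ g i) (r i)))) (sumℤ-neg k _)))

  v-det : ∀ k (β : Fin k → Carrier) r → HasValuations k β r → Sorted k r → ResiduallyIndependent k β r →
    v (det k (λ i j → β i ^ᴿ (p ^ toℕ j))) ≡ fin (ℤ.- sumℤ k (λ j → + (p ^ toℕ j) ℤ.* r j))
  v-det k β r β-val r-sorted β-independent = ≡.trans
    (v-cong (DeterminantProperties.det-cong commRing k (λ i j → ^ᴿ-congʳ (β i) (≡.sym (^[+]≡^ p 0 j)))))
    (≡.trans (v-moore k 0 β r β-val r-sorted β-independent) (≡.cong (fin ∘ ℤ.-_) (weight₀≡sumℤ k r)))

lemma6p2 : ∀ {c ℓ : Level} {p : ℕ} (F : LocalField c ℓ p) → let open LocalField F in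
    ∀ (k : ℕ) (β : Fin k → Carrier) (r : Fin k → ℤ) →
    (∀ i → v (β i) ≡ fin (ℤ.- r i)) →
    (∀ (i j : Fin k) → i Fin.≤ j → r i ℤ.≤ r j) →
    (∀ (i j : Fin k) → i Fin.< j → r i ≡ r j →
      ∀ (a : Fin k → ℕ) → (∀ l → l Fin.< i ⊎ j Fin.< l → a l ≡ 0) →
      fin (+ 1 ℤ.- r i) ≤∞ v (sumᴿ k (λ l → a l ·ᴿ β l)) →
      ∀ l → i Fin.≤ l → l Fin.≤ j → p ∣ a l) →
    let M : Fin k → Fin k → Carrier
        M i j = β i ^ᴿ (p ^ toℕ j)
        S : ℤ
        S = ℤ.- sumℤ k (λ j → + (p ^ toℕ j) ℤ.* r j)
    in (∀ (σ : Permutation′ k) → fin S ≤∞ v (prodᴿ k (λ i → M i (σ ⟨$⟩ʳ i))))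
       × v (prodᴿ k (λ i → M i i)) ≡ fin S
       × v (det k M) ≡ fin S
lemma6p2 {p = 0}             F = contradiction (LocalField.p-prime F) ¬prime[0]
lemma6p2 {p = 1}             F = contradiction (LocalField.p-prime F) ¬prime[1]
lemma6p2 {p = suc (suc p-2)} F k β r β-val r-sorted β-independent =
  leibnizTerm-≥ , v-prodᴿ-^ k β r (λ i → p ^ toℕ i) β-val , v-det k β r β-val r-sorted β-independent
  where
  open LocalField F
  open Weight p-2 using (p; sumℤ-permute-≤)
  open MooreValuation p-2 F
  S = ℤ.- sumℤ k (λ j → + (p ^ toℕ j) ℤ.* r j)
  leibnizTerm-≥ : ∀ σ → fin S ≤∞ v (prodᴿ k (λ i → β i ^ᴿ (p ^ toℕ (σ ⟨$⟩ʳ i))))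
  leibnizTerm-≥ σ = ≡.subst (fin S ≤∞_) (≡.sym (v-prodᴿ-^ k β r (λ i → p ^ toℕ (σ ⟨$⟩ʳ i)) β-val))
    (fin≤fin (ℤP.neg-mono-≤ (sumℤ-permute-≤ k σ r r-sorted)))
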